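{- Let $p$ be an odd prime. Then $$\sum_{k=0}^{p-1}\frac{F_k}{(-4)^k}\binom{2k}k\equiv\frac{1-(\frac p5)}2\pmod p,\qquad \sum_{k=0}^{p-1}\frac{L_k}{(-4)^k}\binom{2k}k\equiv\frac{5(\frac p5)-1}2\pmod p,$$ $$\sum_{k=0}^{p-1}\frac{F_k}{8^k}\binom{2k}k\equiv\left(\frac 2p\right)\frac{(\frac p5)-1}2\pmod p,\qquad \sum_{k=0}^{p-1}\frac{L_k}{8^k}\binom{2k}k\equiv\left(\frac 2p\right)\frac{5(\frac p5)-1}2\pmod p.$$
   Context: $F_n$ and $L_n$ are the Fibonacci and Lucas numbers: $F_0=0,F_1=1$, $L_0=2,L_1=1$, $X_{n+1}=X_n+X_{n-1}$. $(\frac{\cdot}{\cdot})$ denotes the Legendre symbol. Congruences between rationals with denominators prime to $p$ are understood in the ring of such rationals. -}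

module Defs where

open import Data.Nat as ℕ using (ℕ; zero; suc; _^_; NonZero)
open import Data.Nat.Properties using (m^n≢0)
open import Data.Nat.Combinatorics using (_C_)
open import Data.Nat.Coprimality using (Coprime)
open import Data.Nat.DivMod using (_%_)
open import Data.Integer as ℤ using (ℤ; +_; -[1+_])
open import Data.Integer.Divisibility using () renaming (_∣_ to _∣ℤ_)
open import Data.Rational as ℚ using (ℚ; ↥_; ↧ₙ_; _/_)
open import Data.Bool using (Bool; true; false; if_then_else_)
open import Data.List using (List; upTo)
open import Data.Bool.ListAction using (any)
open import Data.Product using (_×_)
open import Relation.Nullary.Decidable using (⌊_⌋)

fib : ℕ → ℕ
fib 0 = 0
fib 1 = 1
fib (suc (suc n)) = fib (suc n) ℕ.+ fib n

lucas : ℕ → ℕ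
lucas 0 = 2
lucas 1 = 1
lucas (suc (suc n)) = lucas (suc n) ℕ.+ lucas n

sumℚ : ℕ → (ℕ → ℚ) → ℚ
sumℚ zero f = ℚ.0ℚ
sumℚ (suc n) f = sumℚ n f ℚ.+ f n

_≡_[modℚ_] : ℚ → ℚ → ℕ → Set
x ≡ y [modℚ p ] =
  Coprime (↧ₙ (x ℚ.- y)) p × ((+ p) ∣ℤ (↥ (x ℚ.- y)))

isSquareMod : ℕ → (p : ℕ) → .{{NonZero p}} → Bool
isSquareMod r p = any (λ x → ⌊ (x ℕ.* x) % p ℕ.≟ r ⌋) (upTo p)

legendreAux : ℕ → (p : ℕ) → .{{NonZero p}} → ℤ
legendreAux zero p = + 0
legendreAux r@(suc _) p = if isSquareMod r p then + 1 else -[1+ 0 ]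

legendre : ℤ → (p : ℕ) → .{{NonZero p}} → ℤ
legendre a p = legendreAux (a ℤ.%ℕ p) p

termNeg4 : (ℕ → ℕ) → ℕ → ℚ
termNeg4 X k = ((-[1+ 0 ] ℤ.^ k) ℤ.* (+ (X k ℕ.* ((2 ℕ.* k) C k)))) / (4 ^ k)
  where instance _ = m^n≢0 4 k

term8 : (ℕ → ℕ) → ℕ → ℚ
term8 X k = (+ (X k ℕ.* ((2 ℕ.* k) C k))) / (8 ^ k)
  where instance _ = m^n≢0 8 k

halfℚ : ℤ → ℚ
halfℚ z = z / 2

open import Data.Nat.Primality using (Prime; prime⇒nonZero)

legendreP : ℤ → (p : ℕ) → Prime p → ℤ
legendreP a p pr = legendre a p {{prime⇒nonZero pr}}

-- Write p = 2n + 1.  Modulo p, C(2k,k) ≡ (−4)ᵏ C(n,k) for every k < p, so with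
-- h = (p + 1)/2, the inverse of 2, the sums reduce to Σ C(n,k) Xₖ = X₂ₙ and to
-- Σ C(n,k) (−h)ᵏ Xₖ ≡ hⁿ Σ C(n,k) 2ⁿ⁻ᵏ (−1)ᵏ Xₖ = hⁿ (F₂ₙ₊₁ X₀ − F₂ₙ X₁) for any
-- Fibonacci-like X, where hⁿ ≡ 2ⁿ ≡ (2/p) by Euler's criterion (pair each y with
-- a/y, and use Wilson's theorem).  It remains to know F_{p−1} and F_p modulo p.
-- For a primitive fifth root of unity ζ the golden ratio is φ = −ζ²(1 + ζ), and
-- φᵖ = F_{p−1} + F_p φ.  Frobenius gives (1 + ζ)ᵖ ≡ 1 + ζᵖ, hence
-- φᵖ ≡ −ζ²ʳ(1 + ζʳ) with r = p mod 5, and comparing coordinates in ℤ[ζ] yields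
-- 2F_{p−1} ≡ 1 − (p/5) and 2L_{p−1} ≡ 5(p/5) − 1 without quadratic reciprocity.

module Submission where

open import Data.Bool using (Bool; true; false; T; if_then_else_)
open import Data.Empty using (⊥-elim)
open import Data.Integer as ℤ using (ℤ; +_; -[1+_]; _+_; _*_; -_; _-_; _^_; ∣_∣)
open import Data.Integer.Properties as ℤ using ()
open import Data.Integer.Tactic.RingSolver using (solve; solve-∀)
import Data.Integer.GCD as ℤ
open import Data.List using (List; []; _∷_; _++_; length; filter; applyUpTo; upTo)
open import Data.List.Membership.Propositional using (_∈_; lose)
open import Data.List.Membership.Propositional.Properties using (∈-applyUpTo⁺; ∈-applyUpTo⁻; ∈-filter⁺; ∈-filter⁻; ∈-upTo⁺)
open import Data.List.Properties using (filter-all; filter-reject; filter-accept; length-applyUpTo; applyUpTo-∷ʳ)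
open import Data.List.Relation.Binary.Permutation.Propositional using (_↭_; ↭-refl; ↭-prep; ↭-swap; ↭-trans)
open import Data.List.Relation.Binary.Permutation.Propositional.Properties using (↭-length)
open import Data.List.Relation.Unary.All as All using ()
open import Data.List.Relation.Unary.All.Properties using (All¬⇒¬Any)
open import Data.List.Relation.Unary.AllPairs using ([]; _∷_)
open import Data.List.Relation.Unary.Any using (here; there; satisfied)
open import Data.List.Relation.Unary.Any.Properties using (any⁺; any⁻)
open import Data.List.Relation.Unary.Unique.Propositional using (Unique)
open import Data.List.Relation.Unary.Unique.Propositional.Properties using (applyUpTo⁺₁; filter⁺)
open import Data.Nat as ℕ using (ℕ; zero; suc; _∸_; _%_; _/_)
open import Data.Nat.Combinatorics using (_C_; nCk+nC[k+1]≡[n+1]C[k+1]; nC1≡n; nCn≡1; nCk≡nC[n∸k])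
open import Data.Nat.Combinatorics.Specification using (k>n⇒nCk≡0)
open import Data.Nat.Coprimality as Coprimality using (Coprime)
open import Data.Nat.DivMod using (m≡m%n+[m/n]*n; m%n<n; m<n⇒m%n≡m)
open import Data.Nat.Divisibility as ℕ using (_∣_; divides; m%n≡0⇒n∣m)
open import Data.Nat.GeneralisedArithmetic using (iterate)
open import Data.Nat.ListAction using (product)
open import Data.Nat.ListAction.Properties using (product-++; product-↭)
open import Data.Nat.Primality using (Prime; euclidsLemma; prime⇒irreducible; prime⇒nonTrivial)
open import Data.Nat.Properties as ℕ using ()
open import Data.Nat.Tactic.RingSolver as ℕ-Solver using ()
open import Data.Product using (_×_; _,_; ∃; proj₁; proj₂)
open import Data.Rational as ℚ using (ℚ; mkℚ; ↥_; ↧_; ↧ₙ_)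
open import Data.Rational.Properties as ℚ using ()
open import Data.Rational.Unnormalised using (*≡*)
open import Data.Sum using (_⊎_; inj₁; inj₂; [_,_]′)
open import Relation.Binary.Bundles using (Setoid)
open import Relation.Binary.PropositionalEquality
import Relation.Binary.Reasoning.Setoid as SetoidReasoning
open import Relation.Nullary using (¬_; ¬?)
open import Relation.Nullary.Decidable using (⌊_⌋; toWitness; fromWitness)
open import Defs

infix 4 _≡_[mod_]

record _≡_[mod_] (a b : ℤ) (p : ℕ) : Set where
  constructor mod-witness
  field
    quotient : ℤ
    equation : a ≡ b + quotient * + p

module _ {p : ℕ} where

  private P = + p

  mod-refl : ∀ {a} → a ≡ a [mod p ]
  mod-refl {a} = mod-witness (+ 0) (lemma a P)
    where lemma : ∀ a P → a ≡ a + + 0 * P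
          lemma = solve-∀

  ≡⇒mod : ∀ {a b} → a ≡ b → a ≡ b [mod p ]
  ≡⇒mod refl = mod-refl

  mod-sym : ∀ {a b} → a ≡ b [mod p ] → b ≡ a [mod p ]
  mod-sym {b = b} (mod-witness q refl) = mod-witness (- q) (lemma b q P)
    where lemma : ∀ b q P → b ≡ b + q * P + (- q) * P
          lemma = solve-∀

  mod-trans : ∀ {a b c} → a ≡ b [mod p ] → b ≡ c [mod p ] → a ≡ c [mod p ]
  mod-trans {c = c} (mod-witness q refl) (mod-witness r refl) = mod-witness (r + q) (lemma c q r P)
    where lemma : ∀ c q r P → c + r * P + q * P ≡ c + (r + q) * P
          lemma = solve-∀

  mod-+ : ∀ {a b c d} → a ≡ b [mod p ] → c ≡ d [mod p ] → a + c ≡ b + d [mod p ]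
  mod-+ {b = b} {d = d} (mod-witness q refl) (mod-witness r refl) = mod-witness (q + r) (lemma b d q r P)
    where lemma : ∀ b d q r P → (b + q * P) + (d + r * P) ≡ (b + d) + (q + r) * P
          lemma = solve-∀

  mod-* : ∀ {a b c d} → a ≡ b [mod p ] → c ≡ d [mod p ] → a * c ≡ b * d [mod p ]
  mod-* {b = b} {d = d} (mod-witness q refl) (mod-witness r refl) =
    mod-witness (b * r + q * d + q * r * P) (lemma b d q r P)
    where lemma : ∀ b d q r P → (b + q * P) * (d + r * P) ≡ b * d + (b * r + q * d + q * r * P) * P
          lemma = solve-∀

  mod-neg : ∀ {a b} → a ≡ b [mod p ] → - a ≡ - b [mod p ]
  mod-neg {b = b} (mod-witness q refl) = mod-witness (- q) (lemma b q P)
    where lemma : ∀ b q P → - (b + q * P) ≡ - b + (- q) * P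
          lemma = solve-∀

  mod-sub : ∀ {a b c d} → a ≡ b [mod p ] → c ≡ d [mod p ] → a - c ≡ b - d [mod p ]
  mod-sub a≡b c≡d = mod-+ a≡b (mod-neg c≡d)

  mod-^ : ∀ {a b} k → a ≡ b [mod p ] → a ^ k ≡ b ^ k [mod p ]
  mod-^ zero    a≡b = mod-refl
  mod-^ (suc k) a≡b = mod-* a≡b (mod-^ k a≡b)

  mod-*ˡ : ∀ c {a b} → a ≡ b [mod p ] → c * a ≡ c * b [mod p ]
  mod-*ˡ c = mod-* (mod-refl {c})

  mod-*ʳ : ∀ c {a b} → a ≡ b [mod p ] → a * c ≡ b * c [mod p ]
  mod-*ʳ c a≡b = mod-* a≡b (mod-refl {c})

  multiple≡0 : ∀ q → P * q ≡ + 0 [mod p ]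
  multiple≡0 q = mod-witness q (trans (ℤ.*-comm P q) (sym (ℤ.+-identityˡ (q * P))))

  mod⇒difference≡0 : ∀ {a b} → a ≡ b [mod p ] → a - b ≡ + 0 [mod p ]
  mod⇒difference≡0 {b = b} a≡b = mod-trans (mod-sub a≡b (mod-refl {b})) (≡⇒mod (ℤ.+-inverseʳ b))

  difference≡0⇒mod : ∀ {a b} → a - b ≡ + 0 [mod p ] → a ≡ b [mod p ]
  difference≡0⇒mod {a} {b} (mod-witness q a-b≡qp) = mod-witness q (trans (lemma a b) (trans (cong (_+ b) a-b≡qp) (lemma′ b q P)))
    where
    lemma : ∀ a b → a ≡ a - b + b
    lemma = solve-∀
    lemma′ : ∀ b q P → + 0 + q * P + b ≡ b + q * P
    lemma′ = solve-∀

modSetoid : ℕ → Setoid _ _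
modSetoid p = record
  { Carrier = ℤ
  ; _≈_ = λ a b → a ≡ b [mod p ]
  ; isEquivalence = record { refl = mod-refl ; sym = mod-sym ; trans = mod-trans }
  }

module ModReasoning (p : ℕ) = SetoidReasoning (modSetoid p)

module _ {A : Set} where

  iterate-+ : ∀ (f : A → A) x m k → iterate f x (m ℕ.+ k) ≡ iterate f (iterate f x m) k
  iterate-+ f x zero    k = refl
  iterate-+ f x (suc m) k = iterate-+ f (f x) m k

  iterate-commute : ∀ (f g : A → A) → (∀ x → f (g x) ≡ g (f x)) →
                    ∀ x m → iterate f (g x) m ≡ g (iterate f x m)
  iterate-commute f g fg≡gf x zero    = refl
  iterate-commute f g fg≡gf x (suc m) = trans (cong (λ y → iterate f y m) (fg≡gf x)) (iterate-commute f g fg≡gf (f x) m)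

  iterate-compose : ∀ (f g : A → A) → (∀ x → f (g x) ≡ g (f x)) →
                    ∀ x m → iterate (λ y → f (g y)) x m ≡ iterate f (iterate g x m) m
  iterate-compose f g fg≡gf x zero    = refl
  iterate-compose f g fg≡gf x (suc m) = begin
    iterate (λ y → f (g y)) (f (g x)) m  ≡⟨ iterate-compose f g fg≡gf (f (g x)) m ⟩
    iterate f (iterate g (f (g x)) m) m  ≡⟨ cong (λ y → iterate f y m) (iterate-commute g f (λ y → sym (fg≡gf y)) (g x) m) ⟩
    iterate f (f (iterate g (g x) m)) m  ∎
    where open ≡-Reasoning

  iterate-homomorphic : ∀ (f : A → A) (_∙_ : A → A → A) → (∀ x y → f (x ∙ y) ≡ f x ∙ f y) →
                        ∀ x y m → iterate f (x ∙ y) m ≡ iterate f x m ∙ iterate f y m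
  iterate-homomorphic f _∙_ f-homo x y zero    = refl
  iterate-homomorphic f _∙_ f-homo x y (suc m) =
    trans (cong (λ z → iterate f z m) (f-homo x y)) (iterate-homomorphic f _∙_ f-homo (f x) (f y) m)

  iterate-preserves : ∀ (f : A → A) (_∼_ : A → A → Set) → (∀ {x y} → x ∼ y → f x ∼ f y) →
                      ∀ {x y} m → x ∼ y → iterate f x m ∼ iterate f y m
  iterate-preserves f _∼_ f-pres zero    x∼y = x∼y
  iterate-preserves f _∼_ f-pres (suc m) x∼y = iterate-preserves f _∼_ f-pres m (f-pres x∼y)

  iterate-periodic : ∀ (f : A → A) N .{{_ : ℕ.NonZero N}} → (∀ x → iterate f x N ≡ x) →
                     ∀ x m → iterate f x m ≡ iterate f x (m % N)
  iterate-periodic f N period x m = begin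
    iterate f x m                                  ≡⟨ cong (iterate f x) (m≡m%n+[m/n]*n m N) ⟩
    iterate f x (m % N ℕ.+ m / N ℕ.* N)            ≡⟨ iterate-+ f x (m % N) _ ⟩
    iterate f (iterate f x (m % N)) (m / N ℕ.* N)  ≡⟨ periods (m / N) _ ⟩
    iterate f x (m % N)                            ∎
    where
    open ≡-Reasoning
    periods : ∀ q y → iterate f y (q ℕ.* N) ≡ y
    periods zero    y = refl
    periods (suc q) y = trans (iterate-+ f y N (q ℕ.* N)) (trans (periods q _) (period y))

  iterate-involution-odd : ∀ (f : A → A) → (∀ x → f (f x) ≡ x) → ∀ x n → iterate f x (suc (n ℕ.+ n)) ≡ f x
  iterate-involution-odd f f²≡id x zero    = refl
  iterate-involution-odd f f²≡id x (suc n) = begin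
    iterate f (f (f x)) (n ℕ.+ suc n)  ≡⟨ cong (λ y → iterate f y (n ℕ.+ suc n)) (f²≡id x) ⟩
    iterate f x (n ℕ.+ suc n)          ≡⟨ cong (iterate f x) (ℕ.+-suc n n) ⟩
    iterate f x (suc (n ℕ.+ n))        ≡⟨ iterate-involution-odd f f²≡id x n ⟩
    f x                                ∎
    where open ≡-Reasoning

sumℤ : ℕ → (ℕ → ℤ) → ℤ
sumℤ zero    f = + 0
sumℤ (suc n) f = sumℤ n f + f n

sum-cong : ∀ n {f g : ℕ → ℤ} → (∀ k → k ℕ.< n → f k ≡ g k) → sumℤ n f ≡ sumℤ n g
sum-cong zero    f≡g = refl
sum-cong (suc n) f≡g = cong₂ _+_ (sum-cong n (λ k k<n → f≡g k (ℕ.m<n⇒m<1+n k<n))) (f≡g n ℕ.≤-refl)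

sum-mod : ∀ {p} n {f g : ℕ → ℤ} → (∀ k → k ℕ.< n → f k ≡ g k [mod p ]) →
          sumℤ n f ≡ sumℤ n g [mod p ]
sum-mod zero    f≡g = mod-refl
sum-mod (suc n) f≡g = mod-+ (sum-mod n (λ k k<n → f≡g k (ℕ.m<n⇒m<1+n k<n))) (f≡g n ℕ.≤-refl)

sum-+ : ∀ n (f g : ℕ → ℤ) → sumℤ n (λ k → f k + g k) ≡ sumℤ n f + sumℤ n g
sum-+ zero    f g = refl
sum-+ (suc n) f g = trans (cong (_+ (f n + g n)) (sum-+ n f g)) (lemma (sumℤ n f) (sumℤ n g) (f n) (g n))
  where lemma : ∀ a b c d → a + b + (c + d) ≡ a + c + (b + d)
        lemma = solve-∀

sum-unfoldˡ : ∀ n (f : ℕ → ℤ) → sumℤ (suc n) f ≡ f 0 + sumℤ n (λ k → f (suc k))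
sum-unfoldˡ zero    f = trans (ℤ.+-identityˡ (f 0)) (sym (ℤ.+-identityʳ (f 0)))
sum-unfoldˡ (suc n) f = trans (cong (_+ f (suc n)) (sum-unfoldˡ n f)) (ℤ.+-assoc (f 0) _ _)

sum-zero : ∀ n {f : ℕ → ℤ} → (∀ k → k ℕ.< n → f k ≡ + 0) → sumℤ n f ≡ + 0
sum-zero zero    f≡0 = refl
sum-zero (suc n) f≡0 =
  cong₂ _+_ (sum-zero n (λ k k<n → f≡0 k (ℕ.m<n⇒m<1+n k<n))) (f≡0 n ℕ.≤-refl)

sum-vanishing-tail : ∀ m j (f : ℕ → ℤ) → (∀ k → m ℕ.≤ k → f k ≡ + 0) → sumℤ (m ℕ.+ j) f ≡ sumℤ m f
sum-vanishing-tail m zero    f tail≡0 = cong (λ i → sumℤ i f) (ℕ.+-identityʳ m)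
sum-vanishing-tail m (suc j) f tail≡0 = begin
  sumℤ (m ℕ.+ suc j) f               ≡⟨ cong (λ i → sumℤ i f) (ℕ.+-suc m j) ⟩
  sumℤ (m ℕ.+ j) f + f (m ℕ.+ j)     ≡⟨ cong₂ _+_ (sum-vanishing-tail m j f tail≡0) (tail≡0 _ (ℕ.m≤m+n m j)) ⟩
  sumℤ m f + + 0                     ≡⟨ ℤ.+-identityʳ _ ⟩
  sumℤ m f                           ∎
  where open ≡-Reasoning

-- ((c + d E)ⁿ G)(0), where E is the shift G ↦ G ∘ suc.
binomialTransform : ℕ → ℤ → ℤ → (ℕ → ℤ) → ℤ
binomialTransform zero    c d G = G 0
binomialTransform (suc n) c d G = binomialTransform n c d (λ j → c * G j + d * G (suc j))

binomialTransform-cong : ∀ n c d {G H : ℕ → ℤ} → (∀ j → G j ≡ H j) →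
                         binomialTransform n c d G ≡ binomialTransform n c d H
binomialTransform-cong zero    c d G≡H = G≡H 0
binomialTransform-cong (suc n) c d G≡H =
  binomialTransform-cong n c d (λ j → cong₂ (λ x y → c * x + d * y) (G≡H j) (G≡H (suc j)))

binomialTransform-mod : ∀ {p} n {c c′ d d′} {G H : ℕ → ℤ} → c ≡ c′ [mod p ] → d ≡ d′ [mod p ] →
                        (∀ j → G j ≡ H j [mod p ]) →
                        binomialTransform n c d G ≡ binomialTransform n c′ d′ H [mod p ]
binomialTransform-mod zero    c≡c′ d≡d′ G≡H = G≡H 0
binomialTransform-mod (suc n) c≡c′ d≡d′ G≡H =
  binomialTransform-mod n c≡c′ d≡d′ (λ j → mod-+ (mod-* c≡c′ (G≡H j)) (mod-* d≡d′ (G≡H (suc j))))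

binomialTransform-scale : ∀ n c d l (G : ℕ → ℤ) →
  binomialTransform n c d (λ j → l * G j) ≡ l * binomialTransform n c d G
binomialTransform-scale zero    c d l G = refl
binomialTransform-scale (suc n) c d l G =
  trans (binomialTransform-cong n c d (λ j → lemma c d l (G j) (G (suc j))))
        (binomialTransform-scale n c d l _)
  where lemma : ∀ c d l x y → c * (l * x) + d * (l * y) ≡ l * (c * x + d * y)
        lemma = solve-∀

binomialTransform-homogeneous : ∀ n l c d (G : ℕ → ℤ) →
  binomialTransform n (l * c) (l * d) G ≡ l ^ n * binomialTransform n c d G
binomialTransform-homogeneous zero    l c d G = sym (ℤ.*-identityˡ (G 0))
binomialTransform-homogeneous (suc n) l c d G = begin
  binomialTransform n (l * c) (l * d) (λ j → l * c * G j + l * d * G (suc j))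
    ≡⟨ binomialTransform-cong n _ _ (λ j → lemma l c d (G j) (G (suc j))) ⟩
  binomialTransform n (l * c) (l * d) (λ j → l * (c * G j + d * G (suc j)))
    ≡⟨ binomialTransform-homogeneous n l c d _ ⟩
  l ^ n * binomialTransform n c d (λ j → l * (c * G j + d * G (suc j)))
    ≡⟨ cong (l ^ n *_) (binomialTransform-scale n c d l _) ⟩
  l ^ n * (l * binomialTransform (suc n) c d G)
    ≡⟨ lemma′ (l ^ n) l _ ⟩
  l ^ suc n * binomialTransform (suc n) c d G ∎
  where
  open ≡-Reasoning
  lemma : ∀ l c d x y → l * c * x + l * d * y ≡ l * (c * x + d * y)
  lemma = solve-∀
  lemma′ : ∀ a l b → a * (l * b) ≡ l * a * b
  lemma′ = solve-∀

binomialTransform-1+d : ∀ n d (G : ℕ → ℤ) →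
  binomialTransform n (+ 1) d G ≡ binomialTransform n (+ 1) (+ 1) (λ k → d ^ k * G k)
binomialTransform-1+d zero    d G = sym (ℤ.*-identityˡ (G 0))
binomialTransform-1+d (suc n) d G =
  trans (binomialTransform-1+d n d _)
        (binomialTransform-cong n (+ 1) (+ 1) (λ k → lemma d (d ^ k) (G k) (G (suc k))))
  where lemma : ∀ d e x y → e * (+ 1 * x + d * y) ≡ + 1 * (e * x) + + 1 * (d * e * y)
        lemma = solve-∀

binomial-pascal : ∀ n k → + (suc n C suc k) ≡ + (n C k) + + (n C suc k)
binomial-pascal n k = trans (cong +_ (sym (nCk+nC[k+1]≡[n+1]C[k+1] n k))) (ℤ.pos-+ (n C k) (n C suc k))

binomialTransform-sum : ∀ n (G : ℕ → ℤ) →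
  binomialTransform n (+ 1) (+ 1) G ≡ sumℤ (suc n) (λ k → + (n C k) * G k)
binomialTransform-sum zero    G = sym (trans (ℤ.+-identityˡ _) (ℤ.*-identityˡ (G 0)))
binomialTransform-sum (suc n) G = begin
  binomialTransform n (+ 1) (+ 1) (λ j → + 1 * G j + + 1 * G (suc j))
    ≡⟨ binomialTransform-sum n _ ⟩
  sumℤ (suc n) (λ k → + (n C k) * (+ 1 * G k + + 1 * G (suc k)))
    ≡⟨ sum-cong (suc n) (λ k _ → lemma (+ (n C k)) (G k) (G (suc k))) ⟩
  sumℤ (suc n) (λ k → same k + shifted k)
    ≡⟨ sum-+ (suc n) same shifted ⟩
  sumℤ (suc n) same + sumℤ (suc n) shifted
    ≡⟨ cong (_+ sumℤ (suc n) shifted) (trans (sum-unfoldˡ n same) (cong (_+_ G0) (sym raised-top≡0))) ⟩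
  G0 + sumℤ (suc n) raised + sumℤ (suc n) shifted
    ≡⟨ ℤ.+-assoc G0 _ _ ⟩
  G0 + (sumℤ (suc n) raised + sumℤ (suc n) shifted)
    ≡⟨ cong (_+_ G0) (sym (sum-+ (suc n) raised shifted)) ⟩
  G0 + sumℤ (suc n) (λ k → raised k + shifted k)
    ≡⟨ cong (_+_ G0) (sum-cong (suc n) (λ k _ → pascal-term k)) ⟩
  G0 + sumℤ (suc n) (λ k → + (suc n C suc k) * G (suc k))
    ≡⟨ sym (sum-unfoldˡ (suc n) _) ⟩
  sumℤ (suc (suc n)) (λ k → + (suc n C k) * G k) ∎
  where
  open ≡-Reasoning
  G0 = + (n C 0) * G 0
  same shifted raised : ℕ → ℤ
  same    k = + (n C k) * G k
  shifted k = + (n C k) * G (suc k)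
  raised  k = + (n C suc k) * G (suc k)
  lemma : ∀ c x y → c * (+ 1 * x + + 1 * y) ≡ c * x + c * y
  lemma = solve-∀
  raised-top≡0 : sumℤ (suc n) raised ≡ sumℤ n raised
  raised-top≡0 = trans (cong (_+_ (sumℤ n raised)) (trans (cong (λ c → + c * G (suc n)) (k>n⇒nCk≡0 (ℕ.n<1+n n)))
                                                      (ℤ.*-zeroˡ (G (suc n)))))
                       (ℤ.+-identityʳ _)
  pascal-term : ∀ k → raised k + shifted k ≡ + (suc n C suc k) * G (suc k)
  pascal-term k = trans (sym (ℤ.*-distribʳ-+ (G (suc k)) (+ (n C suc k)) (+ (n C k))))
                        (cong (_* G (suc k)) (trans (ℤ.+-comm (+ (n C suc k)) (+ (n C k))) (sym (binomial-pascal n k))))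

binomialTransform-geometric : ∀ n a → binomialTransform n (+ 1) (+ 1) (a ^_) ≡ (+ 1 + a) ^ n
binomialTransform-geometric zero    a = refl
binomialTransform-geometric (suc n) a = begin
  binomialTransform n (+ 1) (+ 1) (λ j → + 1 * a ^ j + + 1 * a ^ suc j)  ≡⟨ binomialTransform-cong n _ _ (λ j → lemma a (a ^ j)) ⟩
  binomialTransform n (+ 1) (+ 1) (λ j → (+ 1 + a) * a ^ j)             ≡⟨ binomialTransform-scale n _ _ (+ 1 + a) (a ^_) ⟩
  (+ 1 + a) * binomialTransform n (+ 1) (+ 1) (a ^_)                     ≡⟨ cong ((+ 1 + a) *_) (binomialTransform-geometric n a) ⟩
  (+ 1 + a) * (+ 1 + a) ^ n                                             ∎
  where
  open ≡-Reasoning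
  lemma : ∀ a x → + 1 * x + + 1 * (a * x) ≡ (+ 1 + a) * x
  lemma = solve-∀

absorption : ∀ n k → suc k ℕ.* (suc n C suc k) ≡ suc n ℕ.* (n C k)
absorption zero    zero    = refl
absorption zero    (suc k) = trans (cong (suc (suc k) ℕ.*_) (k>n⇒nCk≡0 {1} {suc (suc k)} (ℕ.s≤s (ℕ.s≤s ℕ.z≤n))))
                                   (trans (ℕ.*-zeroʳ (suc (suc k))) (cong (1 ℕ.*_) (sym (k>n⇒nCk≡0 {0} {suc k} (ℕ.s≤s ℕ.z≤n)))))
absorption (suc n) zero    = trans (ℕ.*-identityˡ _) (trans (nC1≡n (suc (suc n))) (sym (ℕ.*-identityʳ (suc (suc n)))))
absorption (suc n) (suc k) = begin
  suc (suc k) ℕ.* (suc (suc n) C suc (suc k))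
    ≡⟨ cong (suc (suc k) ℕ.*_) (sym (nCk+nC[k+1]≡[n+1]C[k+1] (suc n) (suc k))) ⟩
  suc (suc k) ℕ.* (suc n C suc k ℕ.+ suc n C suc (suc k))
    ≡⟨ lemma (suc k) (suc n C suc k) (suc n C suc (suc k)) ⟩
  suc k ℕ.* (suc n C suc k) ℕ.+ suc n C suc k ℕ.+ suc (suc k) ℕ.* (suc n C suc (suc k))
    ≡⟨ cong₂ (λ x y → x ℕ.+ suc n C suc k ℕ.+ y) (absorption n k) (absorption n (suc k)) ⟩
  suc n ℕ.* (n C k) ℕ.+ suc n C suc k ℕ.+ suc n ℕ.* (n C suc k)
    ≡⟨ lemma′ (suc n) (n C k) (n C suc k) (suc n C suc k) ⟩
  suc n ℕ.* (n C k ℕ.+ n C suc k) ℕ.+ suc n C suc k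
    ≡⟨ cong (λ x → suc n ℕ.* x ℕ.+ suc n C suc k) (nCk+nC[k+1]≡[n+1]C[k+1] n k) ⟩
  suc n ℕ.* (suc n C suc k) ℕ.+ suc n C suc k
    ≡⟨ ℕ.+-comm (suc n ℕ.* (suc n C suc k)) _ ⟩
  suc (suc n) ℕ.* (suc n C suc k) ∎
  where
  open ≡-Reasoning
  lemma : ∀ k a b → suc k ℕ.* (a ℕ.+ b) ≡ k ℕ.* a ℕ.+ a ℕ.+ suc k ℕ.* b
  lemma = ℕ-Solver.solve-∀
  lemma′ : ∀ m a b c → m ℕ.* a ℕ.+ c ℕ.+ m ℕ.* b ≡ m ℕ.* (a ℕ.+ b) ℕ.+ c
  lemma′ = ℕ-Solver.solve-∀

∣⇒≡0 : ∀ {p} z → p ∣ ∣ z ∣ → z ≡ + 0 [mod p ]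
∣⇒≡0 {p} (+ n)    (divides q eq) = mod-witness (+ q) (trans (cong +_ eq) (trans (ℤ.pos-* q p) (sym (ℤ.+-identityˡ _))))
∣⇒≡0 {p} -[1+ n ] (divides q eq) = mod-witness (- + q) (begin
  - + suc n            ≡⟨ cong (λ m → - + m) eq ⟩
  - + (q ℕ.* p)        ≡⟨ cong -_ (ℤ.pos-* q p) ⟩
  - (+ q * + p)        ≡⟨ lemma (+ q) (+ p) ⟩
  + 0 + (- + q) * + p  ∎)
  where open ≡-Reasoning
        lemma : ∀ a b → - (a * b) ≡ + 0 + (- a) * b
        lemma = solve-∀

≡0⇒∣ : ∀ {p z} → z ≡ + 0 [mod p ] → p ∣ ∣ z ∣
≡0⇒∣ {p} {z} (mod-witness q eq) =
  divides ∣ q ∣ (trans (cong ∣_∣ (trans eq (ℤ.+-identityˡ (q * + p)))) (ℤ.abs-* q (+ p)))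

mod-% : ∀ p .{{_ : ℕ.NonZero p}} x → + (x % p) ≡ + x [mod p ]
mod-% p x = mod-sym (mod-witness (+ (x / p)) (begin
  + x                            ≡⟨ cong +_ (m≡m%n+[m/n]*n x p) ⟩
  + (x % p ℕ.+ x / p ℕ.* p)      ≡⟨ ℤ.pos-+ (x % p) _ ⟩
  + (x % p) + + (x / p ℕ.* p)    ≡⟨ cong (_+_ (+ (x % p))) (ℤ.pos-* (x / p) p) ⟩
  + (x % p) + + (x / p) * + p    ∎))
  where open ≡-Reasoning

pos-^ : ∀ y k → + (y ℕ.^ k) ≡ (+ y) ^ k
pos-^ y zero    = refl
pos-^ y (suc k) = trans (ℤ.pos-* y (y ℕ.^ k)) (cong (+ y *_) (pos-^ y k))

private
  mod-small-≤ : ∀ {p x y} → x ℕ.≤ y → y ℕ.< p → + x ≡ + y [mod p ] → x ≡ y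
  mod-small-≤ {p} {x} {y} x≤y y<p x≡y with y ∸ x in gap
  ... | zero  = ℕ.≤-antisym x≤y (ℕ.m∸n≡0⇒m≤n gap)
  ... | suc _ = ⊥-elim (ℕ.<⇒≱ (ℕ.≤-<-trans (ℕ.m∸n≤m y x) y<p)
                             (subst (p ℕ.≤_) (sym gap) (ℕ.∣⇒≤ (subst (p ∣_) gap p∣gap))))
    where
    p∣gap : p ∣ y ∸ x
    p∣gap = subst (p ∣_) (trans (cong ∣_∣ (ℤ.m-n≡m⊖n x y)) (ℤ.∣⊖∣-≤ x≤y)) (≡0⇒∣ (mod⇒difference≡0 x≡y))

mod-small : ∀ {p x y} → x ℕ.< p → y ℕ.< p → + x ≡ + y [mod p ] → x ≡ y
mod-small {x = x} {y} x<p y<p x≡y with ℕ.≤-total x y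
... | inj₁ x≤y = mod-small-≤ x≤y y<p x≡y
... | inj₂ y≤x = sym (mod-small-≤ y≤x x<p (mod-sym x≡y))

module _ {p : ℕ} (p-prime : Prime p) where

  mod-euclid : ∀ a b → a * b ≡ + 0 [mod p ] → a ≡ + 0 [mod p ] ⊎ b ≡ + 0 [mod p ]
  mod-euclid a b ab≡0 with euclidsLemma ∣ a ∣ ∣ b ∣ p-prime (subst (p ∣_) (ℤ.abs-* a b) (≡0⇒∣ ab≡0))
  ... | inj₁ p∣a = inj₁ (∣⇒≡0 a p∣a)
  ... | inj₂ p∣b = inj₂ (∣⇒≡0 b p∣b)

  mod-cancelˡ : ∀ c {a b} → ¬ (c ≡ + 0 [mod p ]) → c * a ≡ c * b [mod p ] → a ≡ b [mod p ]
  mod-cancelˡ c {a} {b} c≢0 ca≡cb with mod-euclid c (a - b) (mod-trans (≡⇒mod (lemma c a b)) (mod⇒difference≡0 ca≡cb))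
    where lemma : ∀ c a b → c * (a - b) ≡ c * a - c * b
          lemma = solve-∀
  ... | inj₁ c≡0   = ⊥-elim (c≢0 c≡0)
  ... | inj₂ a-b≡0 = difference≡0⇒mod a-b≡0

  nonzero-below : ∀ {k} → 0 ℕ.< k → k ℕ.< p → ¬ (+ k ≡ + 0 [mod p ])
  nonzero-below {suc k} _ k<p k≡0 = ℕ.<⇒≱ k<p (ℕ.∣⇒≤ (≡0⇒∣ k≡0))

  one≢0 : ¬ (+ 1 ≡ + 0 [mod p ])
  one≢0 = nonzero-below (ℕ.s≤s ℕ.z≤n) (ℕ.nonTrivial⇒n>1 p {{prime⇒nonTrivial p-prime}})

  nonzero-* : ∀ {a b} → ¬ (a ≡ + 0 [mod p ]) → ¬ (b ≡ + 0 [mod p ]) → ¬ (a * b ≡ + 0 [mod p ])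
  nonzero-* {a} {b} a≢0 b≢0 ab≡0 with mod-euclid a b ab≡0
  ... | inj₁ a≡0 = a≢0 a≡0
  ... | inj₂ b≡0 = b≢0 b≡0

  nonzero-^ : ∀ {a} k → ¬ (a ≡ + 0 [mod p ]) → ¬ (a ^ k ≡ + 0 [mod p ])
  nonzero-^ zero    a≢0 = one≢0
  nonzero-^ (suc k) a≢0 = nonzero-* a≢0 (nonzero-^ k a≢0)

  nonzero-pos-^ : ∀ b k → ¬ (+ b ≡ + 0 [mod p ]) → ¬ (+ (b ℕ.^ k) ≡ + 0 [mod p ])
  nonzero-pos-^ b k b≢0 bᵏ≡0 = nonzero-^ k b≢0 (subst (_≡ + 0 [mod p ]) (pos-^ b k) bᵏ≡0)

  prime∣C : ∀ {k} → 0 ℕ.< k → k ℕ.< p → + (p C k) ≡ + 0 [mod p ]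
  prime∣C {suc j} 0<k k<p@(ℕ.s≤s {n = m} _) with mod-euclid (+ suc j) (+ (p C suc j)) kC≡0
    where
    kC≡0 : + suc j * + (p C suc j) ≡ + 0 [mod p ]
    kC≡0 = mod-trans (≡⇒mod (trans (sym (ℤ.pos-* (suc j) _)) (trans (cong +_ (absorption m j)) (ℤ.pos-* (suc m) (m C j)))))
                     (multiple≡0 (+ (m C j)))
  ... | inj₁ k≡0 = ⊥-elim (nonzero-below 0<k k<p k≡0)
  ... | inj₂ C≡0 = C≡0

binomialTransform-frobenius : ∀ {p} → Prime p → ∀ (G : ℕ → ℤ) →
                              binomialTransform p (+ 1) (+ 1) G ≡ G 0 + G p [mod p ]
binomialTransform-frobenius {suc m} p-prime G = begin
  binomialTransform (suc m) (+ 1) (+ 1) G              ≡⟨ binomialTransform-sum (suc m) G ⟩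
  sumℤ (suc m) term + term (suc m)                     ≡⟨ cong (_+ term (suc m)) (sum-unfoldˡ m term) ⟩
  term 0 + sumℤ m (λ k → term (suc k)) + term (suc m)  ≈⟨ mod-+ (mod-+ (mod-refl {a = term 0}) inner≡0) mod-refl ⟩
  term 0 + + 0 + term (suc m)                          ≡⟨ cong₂ _+_ (trans (ℤ.+-identityʳ _) (ℤ.*-identityˡ (G 0)))
                                                                   (cong (λ c → + c * G (suc m)) (nCn≡1 (suc m))) ⟩
  G 0 + + 1 * G (suc m)                                ≡⟨ cong (_+_ (G 0)) (ℤ.*-identityˡ (G (suc m))) ⟩
  G 0 + G (suc m)                                      ∎
  where
  open ModReasoning (suc m)
  term : ℕ → ℤ
  term k = + (suc m C k) * G k
  inner≡0 : sumℤ m (λ k → term (suc k)) ≡ + 0 [mod suc m ]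
  inner≡0 = mod-trans (sum-mod m (λ k k<m → mod-trans (mod-*ʳ (G (suc k)) (prime∣C p-prime (ℕ.s≤s ℕ.z≤n) (ℕ.s≤s k<m)))
                                                      (≡⇒mod (ℤ.*-zeroˡ (G (suc k))))))
                      (≡⇒mod (sum-zero m (λ _ _ → refl)))

fermat : ∀ {p} → Prime p → ∀ x → (+ x) ^ p ≡ + x [mod p ]
fermat {suc m} p-prime zero    = ≡⇒mod (ℤ.*-zeroˡ ((+ 0) ^ m))
fermat {p}     p-prime (suc x) = begin
  (+ 1 + + x) ^ p                             ≡⟨ binomialTransform-geometric p (+ x) ⟨
  binomialTransform p (+ 1) (+ 1) ((+ x) ^_)  ≈⟨ binomialTransform-frobenius p-prime ((+ x) ^_) ⟩
  + 1 + (+ x) ^ p                             ≈⟨ mod-+ (mod-refl {a = + 1}) (fermat p-prime x) ⟩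
  + 1 + + x                                   ∎
  where open ModReasoning p

fermat-1 : ∀ {p} → Prime p → ∀ x → ¬ (+ x ≡ + 0 [mod p ]) → (+ x) ^ (p ∸ 1) ≡ + 1 [mod p ]
fermat-1 {suc m} p-prime x x≢0 =
  mod-cancelˡ p-prime (+ x) x≢0 (mod-trans (fermat p-prime x) (≡⇒mod (sym (ℤ.*-identityʳ (+ x)))))

-- Central binomial coefficients modulo p

binomial-lower : ∀ n k → + suc k * + (n C suc k) ≡ (+ n - + k) * + (n C k)
binomial-lower n k = begin
  k+1 * c′                         ≡⟨ lemma k+1 c c′ ⟩
  k+1 * (c + c′) - k+1 * c         ≡⟨ cong (λ x → k+1 * x - k+1 * c) (binomial-pascal n k) ⟨
  k+1 * + (suc n C suc k) - k+1 * c ≡⟨ cong (_- k+1 * c) (trans (sym (ℤ.pos-* (suc k) _))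
                                                        (trans (cong +_ (absorption n k)) (ℤ.pos-* (suc n) (n C k)))) ⟩
  + suc n * c - k+1 * c             ≡⟨ lemma′ (+ n) (+ k) c ⟩
  (+ n - + k) * c                  ∎
  where
  open ≡-Reasoning
  k+1 = + suc k
  c = + (n C k)
  c′ = + (n C suc k)
  lemma : ∀ a c c′ → a * c′ ≡ a * (c + c′) - a * c
  lemma = solve-∀
  lemma′ : ∀ n k c → (+ 1 + n) * c - (+ 1 + k) * c ≡ (n - k) * c
  lemma′ = solve-∀

central-binomial-step : ∀ k → suc k ℕ.* (suc (suc (2 ℕ.* k)) C suc k) ≡ 2 ℕ.* suc (2 ℕ.* k) ℕ.* ((2 ℕ.* k) C k)
central-binomial-step k = ℕ.*-cancelˡ-≡ _ _ (suc k) (begin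
  suc k ℕ.* (suc k ℕ.* (suc (suc m) C suc k))   ≡⟨ cong (suc k ℕ.*_) (absorption (suc m) k) ⟩
  suc k ℕ.* (suc (suc m) ℕ.* (suc m C k))       ≡⟨ cong (λ x → suc k ℕ.* (suc (suc m) ℕ.* x)) symmetric ⟩
  suc k ℕ.* (suc (suc m) ℕ.* (suc m C suc k))   ≡⟨ lemma (suc k) (suc (suc m)) (suc m C suc k) ⟩
  suc (suc m) ℕ.* (suc k ℕ.* (suc m C suc k))   ≡⟨ cong (suc (suc m) ℕ.*_) (absorption m k) ⟩
  suc (suc m) ℕ.* (suc m ℕ.* (m C k))           ≡⟨ lemma′ k (m C k) ⟩
  suc k ℕ.* (2 ℕ.* suc m ℕ.* (m C k))           ∎)
  where
  open ≡-Reasoning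
  m = 2 ℕ.* k
  symmetric : suc m C k ≡ suc m C suc k
  symmetric = trans (nCk≡nC[n∸k] {k} {suc m} (ℕ.m≤n⇒m≤1+n (ℕ.m≤n*m k 2)))
                    (cong (suc m C_) (trans (cong (_∸ k) (split k)) (ℕ.m+n∸m≡n k (suc k))))
    where split : ∀ k → suc (2 ℕ.* k) ≡ k ℕ.+ suc k
          split = ℕ-Solver.solve-∀
  lemma : ∀ a b c → a ℕ.* (b ℕ.* c) ≡ b ℕ.* (a ℕ.* c)
  lemma = ℕ-Solver.solve-∀
  lemma′ : ∀ k c → suc (suc (2 ℕ.* k)) ℕ.* (suc (2 ℕ.* k) ℕ.* c) ≡ suc k ℕ.* (2 ℕ.* suc (2 ℕ.* k) ℕ.* c)
  lemma′ = ℕ-Solver.solve-∀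

twice-odd≡ : ∀ n k → + (2 ℕ.* suc (2 ℕ.* k)) ≡ - + 4 * (+ n - + k) [mod suc (n ℕ.+ n) ]
twice-odd≡ n k = mod-witness (+ 2) (begin
  + (2 ℕ.* suc (2 ℕ.* k))                          ≡⟨ ℤ.pos-* 2 (suc (2 ℕ.* k)) ⟩
  + 2 * + suc (2 ℕ.* k)                            ≡⟨ cong (_*_ (+ 2)) (trans (ℤ.pos-+ 1 (2 ℕ.* k)) (cong (_+_ (+ 1)) (ℤ.pos-* 2 k))) ⟩
  + 2 * (+ 1 + + 2 * + k)                          ≡⟨ arithmetic (+ n) (+ k) ⟩
  - + 4 * (+ n - + k) + + 2 * (+ 1 + (+ n + + n))  ≡⟨ cong (λ x → - + 4 * (+ n - + k) + + 2 * x)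
                                                           (trans (cong (_+_ (+ 1)) (ℤ.pos-+ n n)) (sym (ℤ.pos-+ 1 (n ℕ.+ n)))) ⟩
  - + 4 * (+ n - + k) + + 2 * + suc (n ℕ.+ n)      ∎)
  where
  open ≡-Reasoning
  arithmetic : ∀ n k → + 2 * (+ 1 + + 2 * k) ≡ - + 4 * (n - k) + + 2 * (+ 1 + (n + n))
  arithmetic = solve-∀

central-binomial-mod : ∀ {n} → Prime (suc (n ℕ.+ n)) → ∀ k → k ℕ.< suc (n ℕ.+ n) →
                       + ((2 ℕ.* k) C k) ≡ (- + 4) ^ k * + (n C k) [mod suc (n ℕ.+ n) ]
central-binomial-mod         p-prime zero    _     = mod-refl
central-binomial-mod {n = n} p-prime (suc k) k+1<p =
  mod-cancelˡ p-prime (+ suc k) (nonzero-below p-prime (ℕ.s≤s ℕ.z≤n) k+1<p) (begin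
    + suc k * + ((2 ℕ.* suc k) C suc k)
      ≡⟨ cong (λ m → + suc k * + (m C suc k)) (ℕ.*-suc 2 k) ⟩
    + suc k * + (suc (suc (2 ℕ.* k)) C suc k)
      ≡⟨ trans (sym (ℤ.pos-* (suc k) _)) (trans (cong +_ (central-binomial-step k)) (ℤ.pos-* (2 ℕ.* suc (2 ℕ.* k)) _)) ⟩
    + (2 ℕ.* suc (2 ℕ.* k)) * + ((2 ℕ.* k) C k)
      ≈⟨ mod-* (twice-odd≡ n k) (central-binomial-mod p-prime k (ℕ.<-trans (ℕ.n<1+n k) k+1<p)) ⟩
    - + 4 * (+ n - + k) * ((- + 4) ^ k * + (n C k))
      ≡⟨ lemma (- + 4) ((- + 4) ^ k) (+ n - + k) (+ (n C k)) ⟩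
    (- + 4) ^ suc k * ((+ n - + k) * + (n C k))
      ≡⟨ cong ((- + 4) ^ suc k *_) (binomial-lower n k) ⟨
    (- + 4) ^ suc k * (+ suc k * + (n C suc k))
      ≡⟨ lemma′ ((- + 4) ^ suc k) (+ suc k) (+ (n C suc k)) ⟩
    + suc k * ((- + 4) ^ suc k * + (n C suc k)) ∎)
  where
  open ModReasoning (suc (n ℕ.+ n))
  lemma : ∀ a b c d → a * c * (b * d) ≡ a * b * (c * d)
  lemma = solve-∀
  lemma′ : ∀ a b c → a * (b * c) ≡ b * (a * c)
  lemma′ = solve-∀

FibonacciLike : (ℕ → ℤ) → Set
FibonacciLike G = ∀ j → G (suc (suc j)) ≡ G (suc j) + G j

fib-fibonacciLike : FibonacciLike (λ j → + fib j)
fib-fibonacciLike j = ℤ.pos-+ (fib (suc j)) (fib j)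

lucas-fibonacciLike : FibonacciLike (λ j → + lucas j)
lucas-fibonacciLike j = ℤ.pos-+ (lucas (suc j)) (lucas j)

fibonacciLike-unique : ∀ G H → FibonacciLike G → FibonacciLike H → G 0 ≡ H 0 → G 1 ≡ H 1 → ∀ j → G j ≡ H j
fibonacciLike-unique G H G-rec H-rec G0≡H0 G1≡H1 zero          = G0≡H0
fibonacciLike-unique G H G-rec H-rec G0≡H0 G1≡H1 (suc zero)    = G1≡H1
fibonacciLike-unique G H G-rec H-rec G0≡H0 G1≡H1 (suc (suc j)) =
  trans (G-rec j) (trans (cong₂ _+_ (fibonacciLike-unique G H G-rec H-rec G0≡H0 G1≡H1 (suc j))
                                    (fibonacciLike-unique G H G-rec H-rec G0≡H0 G1≡H1 j))
                         (sym (H-rec j)))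

lucas≡2fib-fib : ∀ m → + lucas m ≡ + 2 * + fib (suc m) - + fib m
lucas≡2fib-fib = fibonacciLike-unique _ _ lucas-fibonacciLike rhs-fibonacciLike refl refl
  where
  rhs-fibonacciLike : FibonacciLike (λ m → + 2 * + fib (suc m) - + fib m)
  rhs-fibonacciLike j = begin
    + 2 * F (suc (suc (suc j))) - F (suc (suc j))
      ≡⟨ cong₂ (λ x y → + 2 * x - y) (fib-fibonacciLike (suc j)) (fib-fibonacciLike j) ⟩
    + 2 * (F (suc (suc j)) + F (suc j)) - (F (suc j) + F j)
      ≡⟨ lemma (F (suc (suc j))) (F (suc j)) (F j) ⟩
    (+ 2 * F (suc (suc j)) - F (suc j)) + (+ 2 * F (suc j) - F j) ∎
    where
    open ≡-Reasoning
    F : ℕ → ℤ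
    F m = + fib m
    lemma : ∀ a b c → + 2 * (a + b) - (b + c) ≡ (+ 2 * a - b) + (+ 2 * b - c)
    lemma = solve-∀

binomialTransform-fibonacciLike : ∀ n G → FibonacciLike G → binomialTransform n (+ 1) (+ 1) G ≡ G (n ℕ.+ n)
binomialTransform-fibonacciLike zero    G G-rec = refl
binomialTransform-fibonacciLike (suc n) G G-rec = begin
  binomialTransform n (+ 1) (+ 1) (λ j → + 1 * G j + + 1 * G (suc j))
    ≡⟨ binomialTransform-cong n (+ 1) (+ 1) (λ j → trans (lemma (G j) (G (suc j))) (sym (G-rec j))) ⟩
  binomialTransform n (+ 1) (+ 1) (λ j → G (suc (suc j)))
    ≡⟨ binomialTransform-fibonacciLike n (λ j → G (suc (suc j))) (λ j → G-rec (suc (suc j))) ⟩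
  G (suc (suc (n ℕ.+ n)))
    ≡⟨ cong (λ m → G (suc m)) (ℕ.+-suc n n) ⟨
  G (suc n ℕ.+ suc n) ∎
  where
  open ≡-Reasoning
  lemma : ∀ a b → + 1 * a + + 1 * b ≡ b + a
  lemma = solve-∀

binomialTransform-2-1 : ∀ n G → FibonacciLike G →
  binomialTransform n (+ 2) (- + 1) G ≡ + fib (suc (n ℕ.+ n)) * G 0 - + fib (n ℕ.+ n) * G 1
binomialTransform-2-1 zero    G G-rec = lemma (G 0) (G 1)
  where lemma : ∀ a b → a ≡ + 1 * a - + 0 * b
        lemma = solve-∀
binomialTransform-2-1 (suc n) G G-rec = begin
  binomialTransform n (+ 2) (- + 1) G′
    ≡⟨ binomialTransform-2-1 n G′ G′-rec ⟩
  F (suc (n ℕ.+ n)) * G′ 0 - F (n ℕ.+ n) * G′ 1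
    ≡⟨ cong (λ x → F (suc (n ℕ.+ n)) * G′ 0 - F (n ℕ.+ n) * (+ 2 * G 1 + - + 1 * x)) (G-rec 0) ⟩
  F (suc (n ℕ.+ n)) * G′ 0 - F (n ℕ.+ n) * (+ 2 * G 1 + - + 1 * (G 1 + G 0))
    ≡⟨ lemma (F (suc (n ℕ.+ n))) (F (n ℕ.+ n)) (G 0) (G 1) ⟩
  (F (suc (n ℕ.+ n)) + F (n ℕ.+ n) + F (suc (n ℕ.+ n))) * G 0 - (F (suc (n ℕ.+ n)) + F (n ℕ.+ n)) * G 1
    ≡⟨ cong₂ (λ x y → x * G 0 - y * G 1)
             (trans (cong (_+ F (suc (n ℕ.+ n))) (sym (fib-fibonacciLike (n ℕ.+ n))))
                    (sym (fib-fibonacciLike (suc (n ℕ.+ n)))))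
             (sym (fib-fibonacciLike (n ℕ.+ n))) ⟩
  F (suc (suc (suc (n ℕ.+ n)))) * G 0 - F (suc (suc (n ℕ.+ n))) * G 1
    ≡⟨ cong (λ m → F (suc (suc m)) * G 0 - F (suc m) * G 1) (ℕ.+-suc n n) ⟨
  F (suc (suc n ℕ.+ suc n)) * G 0 - F (suc n ℕ.+ suc n) * G 1 ∎
  where
  open ≡-Reasoning
  F : ℕ → ℤ
  F m = + fib m
  G′ : ℕ → ℤ
  G′ j = + 2 * G j + - + 1 * G (suc j)
  G′-rec : FibonacciLike G′
  G′-rec j = trans (cong₂ (λ x y → + 2 * x + - + 1 * y) (G-rec j) (G-rec (suc j)))
                   (lemma′ (G j) (G (suc j)) (G (suc (suc j))))
    where lemma′ : ∀ a b c → + 2 * (b + a) + - + 1 * (c + b) ≡ (+ 2 * b + - + 1 * c) + (+ 2 * a + - + 1 * b)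
          lemma′ = solve-∀
  lemma : ∀ b a g₀ g₁ → b * (+ 2 * g₀ + - + 1 * g₁) - a * (+ 2 * g₁ + - + 1 * (g₁ + g₀)) ≡
                        (b + a + b) * g₀ - (b + a) * g₁
  lemma = solve-∀

binomialTransform-2-1-fib : ∀ n → binomialTransform n (+ 2) (- + 1) (λ j → + fib j) ≡ - + fib (n ℕ.+ n)
binomialTransform-2-1-fib n = trans (binomialTransform-2-1 n _ fib-fibonacciLike) (lemma (+ fib (suc (n ℕ.+ n))) (+ fib (n ℕ.+ n)))
  where lemma : ∀ a b → a * + 0 - b * + 1 ≡ - b
        lemma = solve-∀

binomialTransform-2-1-lucas : ∀ n → binomialTransform n (+ 2) (- + 1) (λ j → + lucas j) ≡ + lucas (n ℕ.+ n)
binomialTransform-2-1-lucas n =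
  trans (binomialTransform-2-1 n _ lucas-fibonacciLike)
        (trans (lemma (+ fib (suc (n ℕ.+ n))) (+ fib (n ℕ.+ n))) (sym (lucas≡2fib-fib (n ℕ.+ n))))
  where lemma : ∀ a b → a * + 2 - b * + 1 ≡ + 2 * a - b
        lemma = solve-∀

-- Fibonacci numbers modulo p

-- a + bζ + cζ² + dζ³ for a primitive fifth root of unity ζ, so that ζ⁴ = −1 − ζ − ζ² − ζ³.
data ℤ[ζ] : Set where
  mk : (a b c d : ℤ) → ℤ[ζ]

c₀ c₁ c₂ c₃ : ℤ[ζ] → ℤ
c₀ (mk a _ _ _) = a
c₁ (mk _ b _ _) = b
c₂ (mk _ _ c _) = c
c₃ (mk _ _ _ d) = d

infixl 6 _⊕_
infixr 8 ⊖_ ζ·_ ζ²·_ [1+ζ]·_ φ·_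

_⊕_ : ℤ[ζ] → ℤ[ζ] → ℤ[ζ]
mk a b c d ⊕ mk a′ b′ c′ d′ = mk (a + a′) (b + b′) (c + c′) (d + d′)

⊖_ : ℤ[ζ] → ℤ[ζ]
⊖ mk a b c d = mk (- a) (- b) (- c) (- d)

ζ·_ : ℤ[ζ] → ℤ[ζ]
ζ· mk a b c d = mk (- d) (a - d) (b - d) (c - d)

ζ²·_ : ℤ[ζ] → ℤ[ζ]
ζ²· u = ζ· ζ· u

[1+ζ]·_ : ℤ[ζ] → ℤ[ζ]
[1+ζ]· u = u ⊕ ζ· u

-- The golden ratio: −ζ²(1 + ζ) = −ζ² − ζ³ = (1 + √5)/2.
φ·_ : ℤ[ζ] → ℤ[ζ]
φ· u = ⊖ ζ²· [1+ζ]· u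

one : ℤ[ζ]
one = mk (+ 1) (+ 0) (+ 0) (+ 0)

mk-cong : ∀ {a b c d a′ b′ c′ d′} → a ≡ a′ → b ≡ b′ → c ≡ c′ → d ≡ d′ → mk a b c d ≡ mk a′ b′ c′ d′
mk-cong refl refl refl refl = refl

ζ·-⊕ : ∀ u v → ζ· (u ⊕ v) ≡ ζ· u ⊕ ζ· v
ζ·-⊕ (mk a b c d) (mk a′ b′ c′ d′) =
  mk-cong (solve (d ∷ d′ ∷ [])) (solve (a ∷ d ∷ a′ ∷ d′ ∷ []))
          (solve (b ∷ d ∷ b′ ∷ d′ ∷ [])) (solve (c ∷ d ∷ c′ ∷ d′ ∷ []))

⊖-involutive : ∀ u → ⊖ ⊖ u ≡ u
⊖-involutive (mk a b c d) = mk-cong (ℤ.neg-involutive a) (ℤ.neg-involutive b) (ℤ.neg-involutive c) (ℤ.neg-involutive d)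

ζ²·-mk : ∀ a b c d → ζ²· mk a b c d ≡ mk (d - c) (- c) (a - c) (b - c)
ζ²·-mk a b c d = mk-cong (solve (c ∷ d ∷ [])) (solve (c ∷ d ∷ [])) (solve (a ∷ c ∷ d ∷ [])) (solve (b ∷ c ∷ d ∷ []))

ζ-order-5 : ∀ u → iterate ζ·_ u 5 ≡ u
ζ-order-5 (mk a b c d) = begin
  ζ· ζ²· ζ²· mk a b c d                                     ≡⟨ cong (λ v → ζ· ζ²· v) (ζ²·-mk a b c d) ⟩
  ζ· ζ²· mk (d - c) (- c) (a - c) (b - c)                   ≡⟨ cong ζ·_ (ζ²·-mk (d - c) (- c) (a - c) (b - c)) ⟩
  ζ· mk (b - c - (a - c)) (- (a - c)) (d - c - (a - c)) (- c - (a - c))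
    ≡⟨ mk-cong (solve abcd) (solve abcd) (solve abcd) (solve abcd) ⟩
  mk a b c d                                                ∎
  where
  open ≡-Reasoning
  abcd = a ∷ b ∷ c ∷ d ∷ []

φ·-mk : ∀ a b c d → φ· mk a b c d ≡ mk (b - d) (b + c - d) (b + c - a) (c - a)
φ·-mk a b c d = mk-cong (solve abcd) (solve abcd) (solve abcd) (solve abcd)
  where abcd = a ∷ b ∷ c ∷ d ∷ []

φ-golden : ∀ u → φ· φ· u ≡ φ· u ⊕ u
φ-golden (mk a b c d) = begin
  φ· φ· mk a b c d                                        ≡⟨ cong φ·_ (φ·-mk a b c d) ⟩
  φ· mk (b - d) (b + c - d) (b + c - a) (c - a)           ≡⟨ φ·-mk (b - d) (b + c - d) (b + c - a) (c - a) ⟩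
  mk (b + c - d - (c - a)) (b + c - d + (b + c - a) - (c - a)) (b + c - d + (b + c - a) - (b - d)) (b + c - a - (b - d))
    ≡⟨ mk-cong (solve abcd) (solve abcd) (solve abcd) (solve abcd) ⟩
  mk (b - d) (b + c - d) (b + c - a) (c - a) ⊕ mk a b c d  ≡⟨ cong (_⊕ mk a b c d) (φ·-mk a b c d) ⟨
  φ· mk a b c d ⊕ mk a b c d                              ∎
  where
  open ≡-Reasoning
  abcd = a ∷ b ∷ c ∷ d ∷ []

ζ²·[1+ζ]·-mk : ∀ a b c d → ζ²· [1+ζ]· mk a b c d ≡ mk (d - b) (d - b - c) (a - b - c) (a - c)
ζ²·[1+ζ]·-mk a b c d = mk-cong (solve abcd) (solve abcd) (solve abcd) (solve abcd)
  where abcd = a ∷ b ∷ c ∷ d ∷ []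

⊖-commutes-ζ²[1+ζ] : ∀ u → ⊖ ζ²· [1+ζ]· u ≡ ζ²· [1+ζ]· ⊖ u
⊖-commutes-ζ²[1+ζ] (mk a b c d) =
  trans (cong ⊖_ (ζ²·[1+ζ]·-mk a b c d))
        (trans (mk-cong (neg-– d b) (neg-–– d b c) (neg-–– a b c) (neg-– a c))
               (sym (ζ²·[1+ζ]·-mk (- a) (- b) (- c) (- d))))
  where
  neg-– : ∀ x y → - (x - y) ≡ - x - - y
  neg-– = solve-∀
  neg-–– : ∀ x y z → - (x - y - z) ≡ - x - - y - - z
  neg-–– = solve-∀

[1+ζ]·ζ²·-mk : ∀ a b c d → [1+ζ]· ζ²· mk a b c d ≡ mk (d - b) (d - b - c) (a - b - c) (a - c)
[1+ζ]·ζ²·-mk a b c d = mk-cong (solve abcd) (solve abcd) (solve abcd) (solve abcd)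
  where abcd = a ∷ b ∷ c ∷ d ∷ []

ζ²-commutes-[1+ζ] : ∀ u → ζ²· [1+ζ]· u ≡ [1+ζ]· ζ²· u
ζ²-commutes-[1+ζ] (mk a b c d) = trans (ζ²·[1+ζ]·-mk a b c d) (sym ([1+ζ]·ζ²·-mk a b c d))

ζ²-order-5 : ∀ u → iterate ζ²·_ u 5 ≡ u
ζ²-order-5 u = trans (iterate-compose ζ·_ ζ·_ (λ _ → refl) u 5) (trans (ζ-order-5 _) (ζ-order-5 u))

φ-power : ∀ u m → iterate φ·_ u m ≡ iterate ⊖_ (iterate ζ²·_ (iterate [1+ζ]·_ u m) m) m
φ-power u m = trans (iterate-compose ⊖_ (λ v → ζ²· [1+ζ]· v) ⊖-commutes-ζ²[1+ζ] u m)
                    (cong (λ v → iterate ⊖_ v m) (iterate-compose ζ²·_ [1+ζ]·_ ζ²-commutes-[1+ζ] u m))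

c₀-⊕ : ∀ u v → c₀ (u ⊕ v) ≡ c₀ u + c₀ v
c₀-⊕ (mk _ _ _ _) (mk _ _ _ _) = refl

c₂-⊕ : ∀ u v → c₂ (u ⊕ v) ≡ c₂ u + c₂ v
c₂-⊕ (mk _ _ _ _) (mk _ _ _ _) = refl

φ-powers-fibonacciLike : ∀ m → iterate φ·_ one (suc (suc m)) ≡ iterate φ·_ one (suc m) ⊕ iterate φ·_ one m
φ-powers-fibonacciLike m = begin
  iterate φ·_ (φ· φ· one) m                   ≡⟨ φ-commutes (φ· one) m ⟩
  φ· iterate φ·_ (φ· one) m                   ≡⟨ cong φ·_ (φ-commutes one m) ⟩
  φ· φ· iterate φ·_ one m                     ≡⟨ φ-golden _ ⟩
  φ· iterate φ·_ one m ⊕ iterate φ·_ one m    ≡⟨ cong (_⊕ iterate φ·_ one m) (φ-commutes one m) ⟨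
  iterate φ·_ (φ· one) m ⊕ iterate φ·_ one m  ∎
  where
  open ≡-Reasoning
  φ-commutes : ∀ u m → iterate φ·_ (φ· u) m ≡ φ· iterate φ·_ u m
  φ-commutes = iterate-commute φ·_ φ·_ (λ _ → refl)

φ-power-c₀ : ∀ m → c₀ (iterate φ·_ one m) ≡ + fib (suc m) - + fib m
φ-power-c₀ = fibonacciLike-unique _ _
  (λ m → trans (cong c₀ (φ-powers-fibonacciLike m)) (c₀-⊕ (iterate φ·_ one (suc m)) (iterate φ·_ one m)))
  (λ m → trans (cong₂ (λ x y → x - y) (fib-fibonacciLike (suc m)) (fib-fibonacciLike m))
               (lemma (+ fib (suc (suc m))) (+ fib (suc m)) (+ fib m)))
  refl refl
  where lemma : ∀ a b c → a + b - (b + c) ≡ a - b + (b - c)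
        lemma = solve-∀

φ-power-c₂ : ∀ m → c₂ (iterate φ·_ one m) ≡ - + fib m
φ-power-c₂ = fibonacciLike-unique _ _
  (λ m → trans (cong c₂ (φ-powers-fibonacciLike m)) (c₂-⊕ (iterate φ·_ one (suc m)) (iterate φ·_ one m)))
  (λ m → trans (cong -_ (fib-fibonacciLike m)) (ℤ.neg-distrib-+ (+ fib (suc m)) (+ fib m)))
  refl refl

infix 4 _≡ᶻ_[mod_]

record _≡ᶻ_[mod_] (u v : ℤ[ζ]) (p : ℕ) : Set where
  constructor coordinatewise
  field
    on-c₀ : c₀ u ≡ c₀ v [mod p ]
    on-c₁ : c₁ u ≡ c₁ v [mod p ]
    on-c₂ : c₂ u ≡ c₂ v [mod p ]
    on-c₃ : c₃ u ≡ c₃ v [mod p ]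

module _ {p : ℕ} where

  ⊖-mod : ∀ {u v} → u ≡ᶻ v [mod p ] → ⊖ u ≡ᶻ ⊖ v [mod p ]
  ⊖-mod {mk _ _ _ _} {mk _ _ _ _} (coordinatewise a b c d) = coordinatewise (mod-neg a) (mod-neg b) (mod-neg c) (mod-neg d)

  ζ·-mod : ∀ {u v} → u ≡ᶻ v [mod p ] → ζ· u ≡ᶻ ζ· v [mod p ]
  ζ·-mod {mk _ _ _ _} {mk _ _ _ _} (coordinatewise a b c d) =
    coordinatewise (mod-neg d) (mod-sub a d) (mod-sub b d) (mod-sub c d)

  ≡⇒modᶻ : ∀ {u v} → u ≡ v → u ≡ᶻ v [mod p ]
  ≡⇒modᶻ refl = coordinatewise mod-refl mod-refl mod-refl mod-refl

  modᶻ-trans : ∀ {u v w} → u ≡ᶻ v [mod p ] → v ≡ᶻ w [mod p ] → u ≡ᶻ w [mod p ]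
  modᶻ-trans (coordinatewise a b c d) (coordinatewise a′ b′ c′ d′) =
    coordinatewise (mod-trans a a′) (mod-trans b b′) (mod-trans c c′) (mod-trans d d′)

[1+ζ]-power-coordinate : ∀ (π : ℤ[ζ] → ℤ) → (∀ u v → π (u ⊕ v) ≡ π u + π v) → ∀ w m →
  π (iterate [1+ζ]·_ w m) ≡ binomialTransform m (+ 1) (+ 1) (λ k → π (iterate ζ·_ w k))
[1+ζ]-power-coordinate π π-⊕ w zero    = refl
[1+ζ]-power-coordinate π π-⊕ w (suc m) =
  trans ([1+ζ]-power-coordinate π π-⊕ ([1+ζ]· w) m) (binomialTransform-cong m (+ 1) (+ 1) (λ k → begin
    π (iterate ζ·_ (w ⊕ ζ· w) k)                                   ≡⟨ cong π (iterate-homomorphic ζ·_ _⊕_ ζ·-⊕ w (ζ· w) k) ⟩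
    π (iterate ζ·_ w k ⊕ iterate ζ·_ (ζ· w) k)                     ≡⟨ π-⊕ _ _ ⟩
    π (iterate ζ·_ w k) + π (iterate ζ·_ (ζ· w) k)
      ≡⟨ cong₂ _+_ (ℤ.*-identityˡ (π (iterate ζ·_ w k))) (ℤ.*-identityˡ (π (iterate ζ·_ (ζ· w) k))) ⟨
    + 1 * π (iterate ζ·_ w k) + + 1 * π (iterate ζ·_ (ζ· w) k)     ∎))
  where open ≡-Reasoning

[1+ζ]-frobenius : ∀ {p} → Prime p → ∀ w → iterate [1+ζ]·_ w p ≡ᶻ w ⊕ iterate ζ·_ w p [mod p ]
[1+ζ]-frobenius {p} p-prime w =
  coordinatewise (on c₀ (λ { (mk _ _ _ _) (mk _ _ _ _) → refl }))
                 (on c₁ (λ { (mk _ _ _ _) (mk _ _ _ _) → refl }))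
                 (on c₂ (λ { (mk _ _ _ _) (mk _ _ _ _) → refl }))
                 (on c₃ (λ { (mk _ _ _ _) (mk _ _ _ _) → refl }))
  where
  on : ∀ (π : ℤ[ζ] → ℤ) → (∀ u v → π (u ⊕ v) ≡ π u + π v) →
       π (iterate [1+ζ]·_ w p) ≡ π (w ⊕ iterate ζ·_ w p) [mod p ]
  on π π-⊕ = mod-trans (≡⇒mod ([1+ζ]-power-coordinate π π-⊕ w p))
                       (mod-trans (binomialTransform-frobenius p-prime _) (≡⇒mod (sym (π-⊕ w (iterate ζ·_ w p)))))

-- −ζ²ʳ(1 + ζʳ), the value of φᵖ = (−ζ²)ᵖ(1 + ζ)ᵖ modulo p when r = p mod 5.
φ-power-residue : ℕ → ℤ[ζ]
φ-power-residue r = ⊖ iterate ζ²·_ (one ⊕ iterate ζ·_ one r) r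

φ-power-mod : ∀ {n} → Prime (suc (n ℕ.+ n)) →
  iterate φ·_ one (suc (n ℕ.+ n)) ≡ᶻ φ-power-residue (suc (n ℕ.+ n) % 5) [mod suc (n ℕ.+ n) ]
φ-power-mod {n} p-prime =
  modᶻ-trans (≡⇒modᶻ (φ-power one p))
    (modᶻ-trans (iterate-preserves ⊖_ _≈_ ⊖-mod p
                   (iterate-preserves ζ²·_ _≈_ (λ x → ζ·-mod (ζ·-mod x)) p ([1+ζ]-frobenius p-prime one)))
      (≡⇒modᶻ (begin
        iterate ⊖_ (iterate ζ²·_ (one ⊕ iterate ζ·_ one p) p) p  ≡⟨ iterate-involution-odd ⊖_ ⊖-involutive _ n ⟩
        ⊖ iterate ζ²·_ (one ⊕ iterate ζ·_ one p) p               ≡⟨ cong ⊖_ (iterate-periodic ζ²·_ 5 ζ²-order-5 _ p) ⟩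
        ⊖ iterate ζ²·_ (one ⊕ iterate ζ·_ one p) (p % 5)
          ≡⟨ cong (λ u → ⊖ iterate ζ²·_ (one ⊕ u) (p % 5)) (iterate-periodic ζ·_ 5 ζ-order-5 one p) ⟩
        φ-power-residue (p % 5)                                   ∎)))
  where
  open ≡-Reasoning
  p = suc (n ℕ.+ n)
  _≈_ : ℤ[ζ] → ℤ[ζ] → Set
  u ≈ v = u ≡ᶻ v [mod p ]

prime≡5 : ∀ {p} → Prime p → p % 5 ≡ 0 → p ≡ 5
prime≡5 {p} p-prime p%5≡0 with prime⇒irreducible p-prime (m%n≡0⇒n∣m p 5 p%5≡0)
... | inj₂ 5≡p = sym 5≡p

-- The coordinates c₀ and c₂ of φᵖ are F_{p−1} and −F_p, and those of φ-power-residue r are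
-- computed for each residue r.
fibonacci-mod-prime : ∀ {n} → Prime (suc (n ℕ.+ n)) →
  (+ 2 * + fib (n ℕ.+ n) ≡ + 1 - legendre (+ suc (n ℕ.+ n)) 5 [mod suc (n ℕ.+ n) ]) ×
  (+ 2 * + lucas (n ℕ.+ n) ≡ + 5 * legendre (+ suc (n ℕ.+ n)) 5 - + 1 [mod suc (n ℕ.+ n) ])
fibonacci-mod-prime {n} p-prime = by-residue (p % 5) refl (m%n<n p 5)
  where
  p = suc (n ℕ.+ n)
  F = + fib (n ℕ.+ n)
  F′ = + fib p
  open _≡ᶻ_[mod_] (φ-power-mod {n} p-prime)
  F≡ : ∀ {r} → p % 5 ≡ r → F ≡ c₀ (φ-power-residue r) [mod p ]
  F≡ refl = mod-trans (≡⇒mod (trans (lemma F′ F)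
                                     (trans (cong (_- F′) (sym (ℤ.pos-+ (fib p) (fib (n ℕ.+ n))))) (sym (φ-power-c₀ p)))))
                      on-c₀
    where lemma : ∀ a b → b ≡ a + b - a
          lemma = solve-∀
  F′≡ : - F′ ≡ c₂ (φ-power-residue (p % 5)) [mod p ]
  F′≡ = mod-trans (≡⇒mod (sym (φ-power-c₂ p))) on-c₂
  2L≡ : ∀ {r} → p % 5 ≡ r → + 2 * + lucas (n ℕ.+ n) ≡ + 2 * (+ 2 * - c₂ (φ-power-residue r) - c₀ (φ-power-residue r)) [mod p ]
  2L≡ refl = mod-trans (≡⇒mod (cong (+ 2 *_) (trans (lucas≡2fib-fib (n ℕ.+ n))
                                                     (cong (λ x → + 2 * x - F) (sym (ℤ.neg-involutive F′))))))
                       (mod-*ˡ (+ 2) (mod-sub (mod-*ˡ (+ 2) (mod-neg F′≡)) (F≡ refl)))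
  by-residue : ∀ r → p % 5 ≡ r → r ℕ.< 5 →
    (+ 2 * F ≡ + 1 - legendreAux r 5 [mod p ]) × (+ 2 * + lucas (n ℕ.+ n) ≡ + 5 * legendreAux r 5 - + 1 [mod p ])
  by-residue 0 p%5≡0 _ with prime≡5 p-prime p%5≡0
  ... | p≡5 = mod-trans (mod-*ˡ (+ 2) (F≡ p%5≡0)) (subst (-[1+ 3 ] ≡ + 1 [mod_]) (sym p≡5) (mod-witness (- + 1) refl)) ,
              mod-trans (2L≡ p%5≡0) (subst (+ 4 ≡ -[1+ 0 ] [mod_]) (sym p≡5) (mod-witness (+ 1) refl))
  by-residue 1 p%5≡r _ = mod-*ˡ (+ 2) (F≡ p%5≡r) , 2L≡ p%5≡r
  by-residue 2 p%5≡r _ = mod-*ˡ (+ 2) (F≡ p%5≡r) , 2L≡ p%5≡r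
  by-residue 3 p%5≡r _ = mod-*ˡ (+ 2) (F≡ p%5≡r) , 2L≡ p%5≡r
  by-residue 4 p%5≡r _ = mod-*ˡ (+ 2) (F≡ p%5≡r) , 2L≡ p%5≡r
  by-residue (suc (suc (suc (suc (suc _))))) _ (ℕ.s≤s (ℕ.s≤s (ℕ.s≤s (ℕ.s≤s (ℕ.s≤s ())))))

-- Euler's criterion

_without_ : List ℕ → ℕ → List ℕ
l without v = filter (λ z → ¬? (z ℕ.≟ v)) l

≡⇒↭ : ∀ {xs ys : List ℕ} → xs ≡ ys → xs ↭ ys
≡⇒↭ refl = ↭-refl

↭-extract : ∀ {v l} → Unique l → v ∈ l → l ↭ v ∷ (l without v)
↭-extract {v} {x ∷ xs} (x∉xs ∷ _) (here refl) =
  ↭-prep x (≡⇒↭ (sym (trans (filter-reject (λ z → ¬? (z ℕ.≟ v)) (λ ne → ne refl))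
                           (filter-all (λ z → ¬? (z ℕ.≟ v)) (All.map (λ x≢z z≡x → x≢z (sym z≡x)) x∉xs)))))
↭-extract {v} {x ∷ xs} (x∉xs ∷ xs-unique) (there v∈xs) =
  ↭-trans (↭-prep x (↭-extract xs-unique v∈xs))
          (↭-trans (↭-swap x v ↭-refl) (↭-prep v (≡⇒↭ (sym (filter-accept (λ z → ¬? (z ℕ.≟ v)) x≢v)))))
  where x≢v : x ≢ v
        x≢v refl = All¬⇒¬Any x∉xs v∈xs

record IsPairing (p : ℕ) (a : ℤ) (σ : ℕ → ℕ) (l : List ℕ) : Set where
  field
    partner-∈    : ∀ {y} → y ∈ l → σ y ∈ l
    involutive   : ∀ {y} → y ∈ l → σ (σ y) ≡ y
    fixpoint-free : ∀ {y} → y ∈ l → σ y ≢ y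
    product≡     : ∀ {y} → y ∈ l → + y * + σ y ≡ a [mod p ]

paired-product : ∀ {p a σ} m {l} → length l ≡ m ℕ.+ m → Unique l → IsPairing p a σ l →
                 + product l ≡ a ^ m [mod p ]
paired-product zero    {[]} _ _ _ = mod-refl
paired-product {p} {a} {σ} (suc m) {x ∷ xs} |l|≡ (x∉xs ∷ xs-unique) pairing =
  mod-trans (≡⇒mod (trans (cong (λ n → + (x ℕ.* n)) (product-↭ xs↭))
                          (trans (ℤ.pos-* x _) (cong (+ x *_) (ℤ.pos-* (σ x) _)))))
            (mod-trans (≡⇒mod (sym (ℤ.*-assoc (+ x) (+ σ x) _)))
                       (mod-* (product≡ (here refl)) (paired-product m |rest|≡ rest-unique rest-pairing)))
  where
  open IsPairing pairing
  σx∈xs : σ x ∈ xs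
  σx∈xs with partner-∈ (here refl)
  ... | here σx≡x  = ⊥-elim (fixpoint-free (here refl) σx≡x)
  ... | there σx∈xs = σx∈xs
  rest = xs without σ x
  xs↭ : xs ↭ σ x ∷ rest
  xs↭ = ↭-extract xs-unique σx∈xs
  |rest|≡ : length rest ≡ m ℕ.+ m
  |rest|≡ = ℕ.suc-injective (trans (sym (↭-length xs↭)) (trans (ℕ.suc-injective |l|≡) (ℕ.+-suc m m)))
  rest-unique : Unique rest
  rest-unique = filter⁺ (λ z → ¬? (z ℕ.≟ σ x)) xs-unique
  from-rest : ∀ {y} → y ∈ rest → y ∈ x ∷ xs
  from-rest y∈ = there (proj₁ (∈-filter⁻ (λ z → ¬? (z ℕ.≟ σ x)) y∈))
  partner-∈-rest : ∀ {y} → y ∈ rest → σ y ∈ rest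
  partner-∈-rest {y} y∈ with ∈-filter⁻ (λ z → ¬? (z ℕ.≟ σ x)) y∈ | partner-∈ (from-rest y∈)
  ... | _    , y≢σx | here σy≡x    = ⊥-elim (y≢σx (trans (sym (involutive (from-rest y∈))) (cong σ σy≡x)))
  ... | y∈xs , _    | there σy∈xs  = ∈-filter⁺ (λ z → ¬? (z ℕ.≟ σ x)) σy∈xs σy≢σx
    where
    σy≢σx : σ y ≢ σ x
    σy≢σx σy≡σx = All¬⇒¬Any x∉xs (subst (_∈ xs) y≡x y∈xs)
      where y≡x : y ≡ x
            y≡x = trans (sym (involutive (from-rest y∈))) (trans (cong σ σy≡σx) (involutive (here refl)))
  rest-pairing : IsPairing p a σ rest
  rest-pairing = record
    { partner-∈ = partner-∈-rest
    ; involutive = λ y∈ → involutive (from-rest y∈)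
    ; fixpoint-free = λ y∈ → fixpoint-free (from-rest y∈)
    ; product≡ = λ y∈ → product≡ (from-rest y∈)
    }

module Division {m : ℕ} (p-prime : Prime (suc (suc m))) where

  private
    p = suc (suc m)

  infixl 7 _÷_

  -- a · y⁻¹, with y⁻¹ = y^(p−2) by Fermat's little theorem.
  _÷_ : ℕ → ℕ → ℕ
  a ÷ y = (a ℕ.* y ℕ.^ m) % p

  ÷<p : ∀ a y → a ÷ y ℕ.< p
  ÷<p a y = m%n<n (a ℕ.* y ℕ.^ m) p

  *-÷ : ∀ a {y} → 0 ℕ.< y → y ℕ.< p → + y * + (a ÷ y) ≡ + a [mod p ]
  *-÷ a {y} 0<y y<p = begin
    + y * + (a ÷ y)           ≈⟨ mod-*ˡ (+ y) (mod-% p (a ℕ.* y ℕ.^ m)) ⟩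
    + y * + (a ℕ.* y ℕ.^ m)   ≡⟨ cong (+ y *_) (trans (ℤ.pos-* a _) (cong (+ a *_) (pos-^ y m))) ⟩
    + y * (+ a * (+ y) ^ m)   ≡⟨ lemma (+ y) (+ a) ((+ y) ^ m) ⟩
    + a * (+ y) ^ suc m       ≈⟨ mod-*ˡ (+ a) (fermat-1 p-prime y (nonzero-below p-prime 0<y y<p)) ⟩
    + a * + 1                 ≡⟨ ℤ.*-identityʳ (+ a) ⟩
    + a                       ∎
    where
    open ModReasoning p
    lemma : ∀ y a t → y * (a * t) ≡ a * (y * t)
    lemma = solve-∀

  ÷-unique : ∀ a {y z} → 0 ℕ.< y → y ℕ.< p → z ℕ.< p → + y * + z ≡ + a [mod p ] → z ≡ a ÷ y
  ÷-unique a 0<y y<p z<p yz≡a =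
    mod-small z<p (÷<p a _) (mod-cancelˡ p-prime _ (nonzero-below p-prime 0<y y<p) (mod-trans yz≡a (mod-sym (*-÷ a 0<y y<p))))

  ÷-positive : ∀ {a y} → ¬ (+ a ≡ + 0 [mod p ]) → 0 ℕ.< y → y ℕ.< p → 0 ℕ.< a ÷ y
  ÷-positive {a} {y} a≢0 0<y y<p with a ÷ y in a÷y≡
  ... | suc _ = ℕ.s≤s ℕ.z≤n
  ... | zero  = ⊥-elim (a≢0 (mod-trans (mod-sym (*-÷ a 0<y y<p))
                                       (≡⇒mod (trans (cong (λ z → + y * + z) a÷y≡) (ℤ.*-zeroʳ (+ y))))))

  ÷-involutive : ∀ {a y} → ¬ (+ a ≡ + 0 [mod p ]) → 0 ℕ.< y → y ℕ.< p → a ÷ (a ÷ y) ≡ y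
  ÷-involutive {a} {y} a≢0 0<y y<p =
    sym (÷-unique a (÷-positive a≢0 0<y y<p) (÷<p a y) y<p (mod-trans (≡⇒mod (ℤ.*-comm _ (+ y))) (*-÷ a 0<y y<p)))

module _ {k : ℕ} (p-prime : Prime (suc (suc k ℕ.+ suc k))) where

  open Division p-prime

  private
    n = suc k
    p = suc (n ℕ.+ n)
    range : List ℕ
    range = applyUpTo suc (n ℕ.+ n)

  range-bounds : ∀ {y} → y ∈ range → 0 ℕ.< y × y ℕ.< p
  range-bounds y∈ with ∈-applyUpTo⁻ suc y∈
  ... | i , i<2n , refl = ℕ.s≤s ℕ.z≤n , ℕ.s≤s i<2n

  ∈-range : ∀ {y} → 0 ℕ.< y → y ℕ.< p → y ∈ range
  ∈-range {suc i} _ (ℕ.s≤s i<2n) = ∈-applyUpTo⁺ suc i<2n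

  range-unique : Unique range
  range-unique = applyUpTo⁺₁ suc (n ℕ.+ n) (λ i<j _ i+1≡j+1 → ℕ.<-irrefl (ℕ.suc-injective i+1≡j+1) i<j)

  nonresidue-product : ∀ {a} → ¬ (+ a ≡ + 0 [mod p ]) → (∀ y → y ℕ.< p → ¬ (+ y * + y ≡ + a [mod p ])) →
                       + product range ≡ (+ a) ^ n [mod p ]
  nonresidue-product {a} a≢0 nonsquare = paired-product n (length-applyUpTo suc (n ℕ.+ n)) range-unique (record
    { partner-∈     = λ y∈ → ∈-range (÷-positive a≢0 (lower y∈) (upper y∈)) (÷<p a _)
    ; involutive    = λ y∈ → ÷-involutive a≢0 (lower y∈) (upper y∈)
    ; fixpoint-free = λ {y} y∈ a÷y≡y →
        nonsquare y (upper y∈) (subst (λ z → + y * + z ≡ + a [mod p ]) a÷y≡y (*-÷ a (lower y∈) (upper y∈)))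
    ; product≡      = λ y∈ → *-÷ a (lower y∈) (upper y∈)
    })
    where
    lower = λ {y} (y∈ : y ∈ range) → proj₁ (range-bounds y∈)
    upper = λ {y} (y∈ : y ∈ range) → proj₂ (range-bounds y∈)

  private
    top = suc (suc (k ℕ.+ k))
    middle : List ℕ
    middle = applyUpTo (λ i → suc (suc i)) (k ℕ.+ k)

    p≡top+1 : p ≡ suc top
    p≡top+1 = cong (λ x → suc (suc x)) (ℕ.+-suc k k)

    top<p : top ℕ.< p
    top<p = ℕ.≤-reflexive (sym p≡top+1)

    top≡-1 : + top ≡ - + 1 [mod p ]
    top≡-1 = mod-witness (+ 1) (trans (lemma (+ top)) (cong (λ x → - + 1 + + 1 * x) (sym (trans (cong +_ p≡top+1) (ℤ.pos-+ 1 top)))))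
      where lemma : ∀ t → t ≡ - + 1 + + 1 * (+ 1 + t)
            lemma = solve-∀

    square≡1 : ∀ {y} → y ℕ.< p → + y * + y ≡ + 1 [mod p ] → y ≡ 1 ⊎ y ≡ top
    square≡1 {y} y<p y²≡1 with mod-euclid p-prime (+ y - + 1) (+ y + + 1) (mod-trans (≡⇒mod (lemma (+ y))) (mod⇒difference≡0 y²≡1))
      where lemma : ∀ y → (y - + 1) * (y + + 1) ≡ y * y - + 1
            lemma = solve-∀
    ... | inj₁ y-1≡0 = inj₁ (mod-small y<p (ℕ.s≤s (ℕ.s≤s ℕ.z≤n)) (difference≡0⇒mod y-1≡0))
    ... | inj₂ y+1≡0 = inj₂ (mod-small y<p top<p (mod-trans y≡-1 (mod-sym top≡-1)))
      where y≡-1 : + y ≡ - + 1 [mod p ]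
            y≡-1 = difference≡0⇒mod (mod-trans (≡⇒mod (cong (_+_ (+ y)) (sym (ℤ.neg-involutive (+ 1))))) y+1≡0)

    1÷1 : 1 ÷ 1 ≡ 1
    1÷1 = sym (÷-unique 1 (ℕ.s≤s ℕ.z≤n) (ℕ.s≤s (ℕ.s≤s ℕ.z≤n)) (ℕ.s≤s (ℕ.s≤s ℕ.z≤n)) mod-refl)

    1÷top : 1 ÷ top ≡ top
    1÷top = sym (÷-unique 1 (ℕ.s≤s ℕ.z≤n) top<p top<p
                  (mod-trans (mod-* top≡-1 top≡-1) (≡⇒mod refl)))

    middle-bounds : ∀ {y} → y ∈ middle → 1 ℕ.< y × y ℕ.< top
    middle-bounds y∈ with ∈-applyUpTo⁻ (λ i → suc (suc i)) y∈
    ... | i , i<2k , refl = ℕ.s≤s (ℕ.s≤s ℕ.z≤n) , ℕ.s≤s (ℕ.s≤s i<2k)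

    ∈-middle : ∀ {y} → 1 ℕ.< y → y ℕ.< top → y ∈ middle
    ∈-middle {suc zero}    (ℕ.s≤s ()) _
    ∈-middle {suc (suc i)} _ (ℕ.s≤s (ℕ.s≤s i<2k)) = ∈-applyUpTo⁺ (λ i → suc (suc i)) i<2k

    middle-pairing : IsPairing p (+ 1) (1 ÷_) middle
    middle-pairing = record
      { partner-∈     = λ y∈ → ∈-middle (1<1÷ y∈) (1÷<top y∈)
      ; involutive    = λ y∈ → ÷-involutive (one≢0 p-prime) (positive y∈) (below-p y∈)
      ; fixpoint-free = fixpoint-free
      ; product≡      = λ y∈ → *-÷ 1 (positive y∈) (below-p y∈)
      }
      where
      positive : ∀ {y} → y ∈ middle → 0 ℕ.< y
      positive y∈ = ℕ.<-trans (ℕ.s≤s ℕ.z≤n) (proj₁ (middle-bounds y∈))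
      below-p : ∀ {y} → y ∈ middle → y ℕ.< p
      below-p y∈ = ℕ.<-trans (proj₂ (middle-bounds y∈)) top<p
      1÷-injective : ∀ {y z} → y ∈ middle → z ℕ.< p → 1 ÷ z ≡ z → 1 ÷ y ≡ z → y ≡ z
      1÷-injective y∈ z<p 1÷z≡z 1÷y≡z =
        trans (sym (÷-involutive (one≢0 p-prime) (positive y∈) (below-p y∈))) (trans (cong (1 ÷_) 1÷y≡z) 1÷z≡z)
      1<1÷ : ∀ {y} → y ∈ middle → 1 ℕ.< 1 ÷ y
      1<1÷ y∈ = ℕ.≤∧≢⇒< (÷-positive (one≢0 p-prime) (positive y∈) (below-p y∈))
                        (λ 1≡1÷y → ℕ.<-irrefl (sym (1÷-injective y∈ (ℕ.s≤s (ℕ.s≤s ℕ.z≤n)) 1÷1 (sym 1≡1÷y)))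
                                               (proj₁ (middle-bounds y∈)))
      1÷<top : ∀ {y} → y ∈ middle → 1 ÷ y ℕ.< top
      1÷<top {y} y∈ = ℕ.≤∧≢⇒< (ℕ.≤-pred (subst (1 ÷ y ℕ.<_) p≡top+1 (÷<p 1 y)))
                             (λ 1÷y≡top → ℕ.<-irrefl (1÷-injective y∈ top<p 1÷top 1÷y≡top) (proj₂ (middle-bounds y∈)))
      fixpoint-free : ∀ {y} → y ∈ middle → 1 ÷ y ≢ y
      fixpoint-free {y} y∈ 1÷y≡y =
        [ (λ y≡1 → ℕ.<-irrefl (sym y≡1) (proj₁ (middle-bounds y∈)))
        , (λ y≡top → ℕ.<-irrefl y≡top (proj₂ (middle-bounds y∈)))
        ]′
        (square≡1 (below-p y∈) (subst (λ z → + y * + z ≡ + 1 [mod p ]) 1÷y≡y (*-÷ 1 (positive y∈) (below-p y∈))))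

  wilson : + product range ≡ - + 1 [mod p ]
  wilson = begin
    + product range                          ≡⟨ cong (λ l → + product l) range≡ ⟩
    + product (1 ∷ (middle ++ top ∷ []))
      ≡⟨ cong +_ (trans (ℕ.*-identityˡ _) (trans (product-++ middle (top ∷ [])) (cong (product middle ℕ.*_) (ℕ.*-identityʳ top)))) ⟩
    + (product middle ℕ.* top)               ≡⟨ ℤ.pos-* (product middle) top ⟩
    + product middle * + top                 ≈⟨ mod-* middle≡1 top≡-1 ⟩
    (+ 1) ^ k * - + 1                        ≡⟨ trans (cong (_* - + 1) (ℤ.^-zeroˡ k)) (ℤ.*-identityˡ (- + 1)) ⟩
    - + 1                                    ∎
    where
    open ModReasoning p
    range≡ : range ≡ 1 ∷ (middle ++ top ∷ [])
    range≡ = cong (1 ∷_) (trans (cong (applyUpTo (λ i → suc (suc i))) (ℕ.+-suc k k))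
                                (sym (applyUpTo-∷ʳ (λ i → suc (suc i)) (k ℕ.+ k))))
    middle≡1 : + product middle ≡ (+ 1) ^ k [mod p ]
    middle≡1 = paired-product k (length-applyUpTo _ (k ℕ.+ k))
                 (applyUpTo⁺₁ _ (k ℕ.+ k) (λ i<j _ i+2≡j+2 → ℕ.<-irrefl (ℕ.suc-injective (ℕ.suc-injective i+2≡j+2)) i<j))
                 middle-pairing

  euler-nonresidue : ∀ {a} → ¬ (+ a ≡ + 0 [mod p ]) → (∀ y → y ℕ.< p → ¬ (+ y * + y ≡ + a [mod p ])) →
                     (+ a) ^ n ≡ - + 1 [mod p ]
  euler-nonresidue a≢0 nonsquare = mod-trans (mod-sym (nonresidue-product a≢0 nonsquare)) wilson

square-^ : ∀ (x : ℤ) n → (x * x) ^ n ≡ x ^ (n ℕ.+ n)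
square-^ x zero    = refl
square-^ x (suc n) = trans (cong (x * x *_) (square-^ x n))
  (trans (ℤ.*-assoc x x _) (cong (λ e → x * x ^ e) (sym (ℕ.+-suc n n))))

euler-residue : ∀ {n} → Prime (suc (n ℕ.+ n)) → ∀ {a x} → ¬ (+ a ≡ + 0 [mod suc (n ℕ.+ n) ]) →
                + x * + x ≡ + a [mod suc (n ℕ.+ n) ] → (+ a) ^ n ≡ + 1 [mod suc (n ℕ.+ n) ]
euler-residue {n} p-prime {a} {x} a≢0 x²≡a =
  mod-trans (mod-^ n (mod-sym x²≡a)) (mod-trans (≡⇒mod (square-^ (+ x) n)) (fermat-1 p-prime x x≢0))
  where
  x≢0 : ¬ (+ x ≡ + 0 [mod suc (n ℕ.+ n) ])
  x≢0 x≡0 = a≢0 (mod-trans (mod-sym x²≡a) (mod-trans (mod-*ʳ (+ x) x≡0) (≡⇒mod (ℤ.*-zeroˡ (+ x)))))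

odd-prime>2 : ∀ {n} → Prime (suc (n ℕ.+ n)) → 2 ℕ.< suc (n ℕ.+ n)
odd-prime>2 {suc k} _ = ℕ.s≤s (ℕ.s≤s (ℕ.≤-trans (ℕ.s≤s ℕ.z≤n) (ℕ.m≤n+m (suc k) k)))

two≢0 : ∀ {n} → Prime (suc (n ℕ.+ n)) → ¬ (+ 2 ≡ + 0 [mod suc (n ℕ.+ n) ])
two≢0 {n} p-prime = nonzero-below p-prime (ℕ.s≤s ℕ.z≤n) (odd-prime>2 {n} p-prime)

two-power-legendre : ∀ {n} (p-prime : Prime (suc (n ℕ.+ n))) →
                     (+ 2) ^ n ≡ legendreP (+ 2) (suc (n ℕ.+ n)) p-prime [mod suc (n ℕ.+ n) ]
two-power-legendre {suc k} p-prime =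
  subst (λ r → (+ 2) ^ suc k ≡ legendreAux r p [mod p ]) (sym (m<n⇒m%n≡m 2<p)) (by-squareness (isSquareMod 2 p) refl)
  where
  p = suc (suc k ℕ.+ suc k)
  2<p = odd-prime>2 {suc k} p-prime
  2≢0 = two≢0 {suc k} p-prime
  square-test : ℕ → Bool
  square-test x = ⌊ (x ℕ.* x) % p ℕ.≟ 2 ⌋
  square⇒mod : ∀ {x} → (x ℕ.* x) % p ≡ 2 → + x * + x ≡ + 2 [mod p ]
  square⇒mod {x} x²%p≡2 = mod-trans (≡⇒mod (sym (ℤ.pos-* x x))) (mod-trans (mod-sym (mod-% p (x ℕ.* x))) (≡⇒mod (cong +_ x²%p≡2)))
  by-squareness : ∀ b → isSquareMod 2 p ≡ b → (+ 2) ^ suc k ≡ (if b then + 1 else -[1+ 0 ]) [mod p ]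
  by-squareness true  is-square with satisfied (any⁻ square-test (upTo p) (subst T (sym is-square) _))
  ... | x , x-square = euler-residue p-prime {x = x} 2≢0 (square⇒mod {x} (toWitness x-square))
  by-squareness false not-square = euler-nonresidue p-prime 2≢0 nonsquare
    where
    nonsquare : ∀ y → y ℕ.< p → ¬ (+ y * + y ≡ + 2 [mod p ])
    nonsquare y y<p y²≡2 = subst T not-square (any⁺ square-test (lose (∈-upTo⁺ y<p) (fromWitness y²%p≡2)))
      where y²%p≡2 : (y ℕ.* y) % p ≡ 2
            y²%p≡2 = mod-small (m%n<n (y ℕ.* y) p) 2<p (mod-trans (mod-% p (y ℕ.* y)) (mod-trans (≡⇒mod (ℤ.pos-* y y)) y²≡2))

-- Reduction of p-integral rationals

infix 4 _↦_[mod_]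

record _↦_[mod_] (x : ℚ) (r : ℤ) (p : ℕ) : Set where
  constructor fraction
  field
    numerator   : ℤ
    denominator : ℕ
    represents  : ↥ x * + denominator ≡ numerator * ↧ x
    p∤denominator : ¬ (+ denominator ≡ + 0 [mod p ])
    residue     : numerator ≡ r * + denominator [mod p ]

↥+↧ : ∀ x y → ↥ (x ℚ.+ y) * (↧ x * ↧ y) ≡ (↥ x * ↧ y + ↥ y * ↧ x) * ↧ (x ℚ.+ y)
↥+↧ x@(mkℚ _ _ _) y@(mkℚ _ _ _) with ℚ.toℚᵘ-homo-+ x y
... | *≡* eq = trans (cong (_* (↧ x * ↧ y)) (sym (ℚ.↥ᵘ-toℚᵘ (x ℚ.+ y))))
                     (trans eq (cong ((↥ x * ↧ y + ↥ y * ↧ x) *_) (ℚ.↧ᵘ-toℚᵘ (x ℚ.+ y))))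

+-represents : ∀ x y {a b d e} → ↥ x * + d ≡ a * ↧ x → ↥ y * + e ≡ b * ↧ y →
               ↥ (x ℚ.+ y) * + (d ℕ.* e) ≡ (a * + e + b * + d) * ↧ (x ℚ.+ y)
+-represents x y {a} {b} {d} {e} x≡a/d y≡b/e = ℤ.*-cancelʳ-≡ _ _ (↧ x * ↧ y) {{↧-nonZero x y}} (begin
  ↥ s * + (d ℕ.* e) * (↧ x * ↧ y)                          ≡⟨ cong (λ z → ↥ s * z * (↧ x * ↧ y)) (ℤ.pos-* d e) ⟩
  ↥ s * (+ d * + e) * (↧ x * ↧ y)                          ≡⟨ lemma₁ (↥ s) (+ d) (+ e) (↧ x * ↧ y) ⟩
  + d * + e * (↥ s * (↧ x * ↧ y))                          ≡⟨ cong (+ d * + e *_) (↥+↧ x y) ⟩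
  + d * + e * ((↥ x * ↧ y + ↥ y * ↧ x) * ↧ s)              ≡⟨ lemma₂ (+ d) (+ e) (↥ x) (↧ x) (↥ y) (↧ y) (↧ s) ⟩
  ((↥ x * + d) * + e * ↧ y + (↥ y * + e) * + d * ↧ x) * ↧ s ≡⟨ cong₂ (λ u v → (u * + e * ↧ y + v * + d * ↧ x) * ↧ s) x≡a/d y≡b/e ⟩
  ((a * ↧ x) * + e * ↧ y + (b * ↧ y) * + d * ↧ x) * ↧ s     ≡⟨ lemma₃ a b (+ d) (+ e) (↧ x) (↧ y) (↧ s) ⟩
  (a * + e + b * + d) * ↧ s * (↧ x * ↧ y)                  ∎)
  where
  open ≡-Reasoning
  s = x ℚ.+ y
  ↧-nonZero : ∀ x y → ℤ.NonZero (↧ x * ↧ y)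
  ↧-nonZero (mkℚ _ _ _) (mkℚ _ _ _) = _
  lemma₁ : ∀ u d e v → u * (d * e) * v ≡ d * e * (u * v)
  lemma₁ = solve-∀
  lemma₂ : ∀ d e ux dx uy dy ds → d * e * ((ux * dy + uy * dx) * ds) ≡ ((ux * d) * e * dy + (uy * e) * d * dx) * ds
  lemma₂ = solve-∀
  lemma₃ : ∀ a b d e dx dy ds → ((a * dx) * e * dy + (b * dy) * d * dx) * ds ≡ (a * e + b * d) * ds * (dx * dy)
  lemma₃ = solve-∀

module _ {p : ℕ} where

  /-↦ : ∀ a d .{{_ : ℕ.NonZero d}} {r} → ¬ (+ d ≡ + 0 [mod p ]) → a ≡ r * + d [mod p ] → (a ℚ./ d) ↦ r [mod p ]
  /-↦ a d p∤d a≡rd = fraction a d (begin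
    ↥ (a ℚ./ d) * + d                    ≡⟨ cong (↥ (a ℚ./ d) *_) (ℚ.↧-/ a d) ⟨
    ↥ (a ℚ./ d) * (↧ (a ℚ./ d) * g)      ≡⟨ lemma (↥ (a ℚ./ d)) (↧ (a ℚ./ d)) g ⟩
    (↥ (a ℚ./ d) * g) * ↧ (a ℚ./ d)      ≡⟨ cong (_* ↧ (a ℚ./ d)) (ℚ.↥-/ a d) ⟩
    a * ↧ (a ℚ./ d)                      ∎) p∤d a≡rd
    where
    open ≡-Reasoning
    g = ℤ.gcd a (+ d)
    lemma : ∀ a b c → a * (b * c) ≡ (a * c) * b
    lemma = solve-∀

module _ {p : ℕ} (p-prime : Prime p) where

  0ℚ-↦ : ℚ.0ℚ ↦ + 0 [mod p ]
  0ℚ-↦ = fraction (+ 0) 1 refl (one≢0 p-prime) mod-refl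

  +-↦ : ∀ {x y r s} → x ↦ r [mod p ] → y ↦ s [mod p ] → x ℚ.+ y ↦ r + s [mod p ]
  +-↦ {x} {y} {r} {s} (fraction a d x≡a/d p∤d a≡rd) (fraction b e y≡b/e p∤e b≡se) =
    fraction (a * + e + b * + d) (d ℕ.* e) (+-represents x y {a} {b} x≡a/d y≡b/e) p∤de (begin
      a * + e + b * + d                   ≈⟨ mod-+ (mod-*ʳ (+ e) a≡rd) (mod-*ʳ (+ d) b≡se) ⟩
      r * + d * + e + s * + e * + d       ≡⟨ lemma r s (+ d) (+ e) ⟩
      (r + s) * (+ d * + e)               ≡⟨ cong ((r + s) *_) (ℤ.pos-* d e) ⟨
      (r + s) * + (d ℕ.* e)               ∎)
    where
    open ModReasoning p
    lemma : ∀ r s d e → r * d * e + s * e * d ≡ (r + s) * (d * e)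
    lemma = solve-∀
    p∤de : ¬ (+ (d ℕ.* e) ≡ + 0 [mod p ])
    p∤de de≡0 with mod-euclid p-prime (+ d) (+ e) (mod-trans (≡⇒mod (sym (ℤ.pos-* d e))) de≡0)
    ... | inj₁ d≡0 = p∤d d≡0
    ... | inj₂ e≡0 = p∤e e≡0

  neg-↦ : ∀ {x r} → x ↦ r [mod p ] → ℚ.- x ↦ - r [mod p ]
  neg-↦ {x} {r} (fraction a d x≡a/d p∤d a≡rd) = fraction (- a) d (begin
    ↥ (ℚ.- x) * + d   ≡⟨ cong (_* + d) (ℚ.↥-neg x) ⟩
    - ↥ x * + d       ≡⟨ ℤ.neg-distribˡ-* (↥ x) (+ d) ⟨
    - (↥ x * + d)     ≡⟨ cong -_ x≡a/d ⟩
    - (a * ↧ x)       ≡⟨ ℤ.neg-distribˡ-* a (↧ x) ⟩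
    - a * ↧ x         ≡⟨ cong (- a *_) (ℚ.↧-neg x) ⟨
    - a * ↧ (ℚ.- x)   ∎) p∤d (mod-trans (mod-neg a≡rd) (≡⇒mod (ℤ.neg-distribˡ-* r (+ d))))
    where open ≡-Reasoning

  sum-↦ : ∀ n {f : ℕ → ℚ} {g : ℕ → ℤ} → (∀ k → k ℕ.< n → f k ↦ g k [mod p ]) → sumℚ n f ↦ sumℤ n g [mod p ]
  sum-↦ zero    f↦g = 0ℚ-↦
  sum-↦ (suc n) f↦g = +-↦ (sum-↦ n (λ k k<n → f↦g k (ℕ.m<n⇒m<1+n k<n))) (f↦g n ℕ.≤-refl)

  ↦0⇒divisible : ∀ {z} → z ↦ + 0 [mod p ] → Coprime (↧ₙ z) p × p ∣ ∣ ↥ z ∣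
  ↦0⇒divisible {z@(mkℚ _ _ z-coprime)} (fraction a d z≡a/d p∤d a≡0d) = coprime , p∣↥z
    where
    a≡0 : a ≡ + 0 [mod p ]
    a≡0 = mod-trans a≡0d (≡⇒mod (ℤ.*-zeroˡ (+ d)))
    |z|d≡|a|↧z : ∣ ↥ z ∣ ℕ.* d ≡ ∣ a ∣ ℕ.* ↧ₙ z
    |z|d≡|a|↧z = trans (sym (ℤ.abs-* (↥ z) (+ d))) (trans (cong ∣_∣ z≡a/d) (ℤ.abs-* a (↧ z)))
    ↧z∣d : ↧ₙ z ∣ d
    ↧z∣d = Coprimality.coprime-divisor (Coprimality.sym (Coprimality.recompute z-coprime)) (divides ∣ a ∣ |z|d≡|a|↧z)
    coprime : Coprime (↧ₙ z) p
    coprime (i∣↧z , i∣p) with prime⇒irreducible p-prime i∣p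
    ... | inj₁ i≡1 = i≡1
    ... | inj₂ refl = ⊥-elim (p∤d (∣⇒≡0 (+ d) (ℕ.∣-trans i∣↧z ↧z∣d)))
    p∣↥z : p ∣ ∣ ↥ z ∣
    p∣↥z with euclidsLemma ∣ ↥ z ∣ d p-prime (subst (p ∣_) (sym |z|d≡|a|↧z) (ℕ.∣-trans (≡0⇒∣ a≡0) (ℕ.m∣m*n (↧ₙ z))))
    ... | inj₁ p∣↥z = p∣↥z
    ... | inj₂ p∣d  = ⊥-elim (p∤d (∣⇒≡0 (+ d) p∣d))

  ↦-≡[modℚ] : ∀ {x y r} → x ↦ r [mod p ] → y ↦ r [mod p ] → x ≡ y [modℚ p ]
  ↦-≡[modℚ] {r = r} x↦r y↦r = ↦0⇒divisible (subst (_ ↦_[mod p ]) (ℤ.+-inverseʳ r) (+-↦ x↦r (neg-↦ y↦r)))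

↦-resp : ∀ {p x r s} → x ↦ r [mod p ] → r ≡ s [mod p ] → x ↦ s [mod p ]
↦-resp (fraction a d x≡a/d p∤d a≡rd) r≡s = fraction a d x≡a/d p∤d (mod-trans a≡rd (mod-*ʳ (+ d) r≡s))

*-^ : ∀ a b k → (a * b) ^ k ≡ a ^ k * b ^ k
*-^ a b zero    = refl
*-^ a b (suc k) = trans (cong (a * b *_) (*-^ a b k)) (lemma a b (a ^ k) (b ^ k))
  where lemma : ∀ a b c d → a * b * (c * d) ≡ a * c * (b * d)
        lemma = solve-∀

module _ {n : ℕ} (p-prime : Prime (suc (n ℕ.+ n))) where

  private
    p = suc (n ℕ.+ n)
    h = + suc n -- (p + 1)/2, the inverse of 2
    ε = legendreP (+ 2) p p-prime
    2≢0 = two≢0 {n} p-prime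

  2h≡1 : + 2 * h ≡ + 1 [mod p ]
  2h≡1 = mod-witness (+ 1) (trans (cong (+ 2 *_) (ℤ.pos-+ 1 n))
                          (trans (lemma (+ n)) (cong (λ x → + 1 + + 1 * x)
                                 (sym (trans (ℤ.pos-+ 1 (n ℕ.+ n)) (cong (_+_ (+ 1)) (ℤ.pos-+ n n)))))))
    where lemma : ∀ n → + 2 * (+ 1 + n) ≡ + 1 + + 1 * (+ 1 + (n + n))
          lemma = solve-∀

  ε²≡1 : ε * ε ≡ + 1 [mod p ]
  ε²≡1 = begin
    ε * ε                  ≈⟨ mod-sym (mod-* (two-power-legendre {n} p-prime) (two-power-legendre {n} p-prime)) ⟩
    (+ 2) ^ n * (+ 2) ^ n  ≡⟨ ℤ.^-distribˡ-+-* (+ 2) n n ⟨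
    (+ 2) ^ (n ℕ.+ n)      ≈⟨ fermat-1 p-prime 2 2≢0 ⟩
    + 1                    ∎
    where open ModReasoning p

  halfℚ-↦ : ∀ t → halfℚ t ↦ h * t [mod p ]
  halfℚ-↦ t = /-↦ t 2 2≢0 (begin
    t                ≡⟨ ℤ.*-identityˡ t ⟨
    + 1 * t          ≈⟨ mod-*ʳ t (mod-sym 2h≡1) ⟩
    + 2 * h * t      ≡⟨ lemma h t ⟩
    h * t * + 2      ∎)
    where
    open ModReasoning p
    lemma : ∀ h t → + 2 * h * t ≡ h * t * + 2
    lemma = solve-∀

  halve : ∀ {u t} → + 2 * u ≡ t [mod p ] → u ≡ h * t [mod p ]
  halve {u} {t} 2u≡t = begin
    u              ≡⟨ ℤ.*-identityˡ u ⟨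
    + 1 * u        ≈⟨ mod-*ʳ u (mod-sym 2h≡1) ⟩
    + 2 * h * u    ≡⟨ lemma h u ⟩
    h * (+ 2 * u)  ≈⟨ mod-*ˡ h 2u≡t ⟩
    h * t          ∎
    where
    open ModReasoning p
    lemma : ∀ h u → + 2 * h * u ≡ h * (+ 2 * u)
    lemma = solve-∀

  termNeg4-↦ : ∀ X k → k ℕ.< p → termNeg4 X k ↦ + (n C k) * + X k [mod p ]
  termNeg4-↦ X k k<p = /-↦ ((-[1+ 0 ] ^ k) * + (X k ℕ.* ((2 ℕ.* k) C k))) (4 ℕ.^ k) {{ℕ.m^n≢0 4 k}}
    (nonzero-pos-^ p-prime 4 k (nonzero-* p-prime 2≢0 2≢0)) (begin
    (-[1+ 0 ] ^ k) * + (X k ℕ.* ((2 ℕ.* k) C k))             ≡⟨ cong (-[1+ 0 ] ^ k *_) (ℤ.pos-* (X k) _) ⟩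
    (-[1+ 0 ] ^ k) * (+ X k * + ((2 ℕ.* k) C k))            ≈⟨ mod-*ˡ (-[1+ 0 ] ^ k) (mod-*ˡ (+ X k) (central-binomial-mod p-prime k k<p)) ⟩
    (-[1+ 0 ] ^ k) * (+ X k * ((- + 4) ^ k * + (n C k)))    ≡⟨ lemma (-[1+ 0 ] ^ k) (+ X k) ((- + 4) ^ k) (+ (n C k)) ⟩
    + (n C k) * + X k * (-[1+ 0 ] ^ k * (- + 4) ^ k)        ≡⟨ cong (+ (n C k) * + X k *_) (*-^ -[1+ 0 ] (- + 4) k) ⟨
    + (n C k) * + X k * (+ 4) ^ k                          ≡⟨ cong (+ (n C k) * + X k *_) (pos-^ 4 k) ⟨
    + (n C k) * + X k * + (4 ℕ.^ k)                        ∎)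
    where
    open ModReasoning p
    lemma : ∀ s x f c → s * (x * (f * c)) ≡ c * x * (s * f)
    lemma = solve-∀

  term8-↦ : ∀ X k → k ℕ.< p → term8 X k ↦ + (n C k) * ((- h) ^ k * + X k) [mod p ]
  term8-↦ X k k<p = /-↦ (+ (X k ℕ.* ((2 ℕ.* k) C k))) (8 ℕ.^ k) {{ℕ.m^n≢0 8 k}}
    (nonzero-pos-^ p-prime 8 k (nonzero-* p-prime 2≢0 (nonzero-* p-prime 2≢0 2≢0))) (begin
    + (X k ℕ.* ((2 ℕ.* k) C k))                              ≡⟨ ℤ.pos-* (X k) _ ⟩
    + X k * + ((2 ℕ.* k) C k)                               ≈⟨ mod-*ˡ (+ X k) (central-binomial-mod p-prime k k<p) ⟩
    + X k * ((- + 4) ^ k * + (n C k))                       ≈⟨ mod-*ˡ (+ X k) (mod-*ʳ (+ (n C k)) (mod-^ k (mod-sym -8h≡-4))) ⟩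
    + X k * ((- h * + 8) ^ k * + (n C k))                   ≡⟨ cong (λ x → + X k * (x * + (n C k))) (*-^ (- h) (+ 8) k) ⟩
    + X k * ((- h) ^ k * (+ 8) ^ k * + (n C k))             ≡⟨ lemma (+ X k) ((- h) ^ k) ((+ 8) ^ k) (+ (n C k)) ⟩
    + (n C k) * ((- h) ^ k * + X k) * (+ 8) ^ k             ≡⟨ cong (+ (n C k) * ((- h) ^ k * + X k) *_) (pos-^ 8 k) ⟨
    + (n C k) * ((- h) ^ k * + X k) * + (8 ℕ.^ k)           ∎)
    where
    open ModReasoning p
    lemma : ∀ x g e c → x * (g * e * c) ≡ c * (g * x) * e
    lemma = solve-∀
    -8h≡-4 : - h * + 8 ≡ - + 4 [mod p ]
    -8h≡-4 = mod-trans (≡⇒mod (lemma′ h)) (mod-trans (mod-*ˡ (- + 4) 2h≡1) (≡⇒mod (ℤ.*-identityʳ (- + 4))))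
      where lemma′ : ∀ h → - h * + 8 ≡ - + 4 * (+ 2 * h)
            lemma′ = solve-∀

  sum-binomial : ∀ (G : ℕ → ℤ) → sumℤ p (λ k → + (n C k) * G k) ≡ binomialTransform n (+ 1) (+ 1) G
  sum-binomial G = trans (sum-vanishing-tail (suc n) n _ tail≡0) (sym (binomialTransform-sum n G))
    where
    tail≡0 : ∀ k → suc n ℕ.≤ k → + (n C k) * G k ≡ + 0
    tail≡0 k n<k = trans (cong (λ c → + c * G k) (k>n⇒nCk≡0 n<k)) (ℤ.*-zeroˡ (G k))

  sum-termNeg4 : ∀ X → FibonacciLike (λ j → + X j) → ∀ t → + 2 * + X (n ℕ.+ n) ≡ t [mod p ] →
                 sumℚ p (termNeg4 X) ≡ halfℚ t [modℚ p ]
  sum-termNeg4 X X-rec t 2X≡t = ↦-≡[modℚ] p-prime (↦-resp (sum-↦ p-prime p (termNeg4-↦ X)) sum≡) (halfℚ-↦ t)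
    where
    sum≡ : sumℤ p (λ k → + (n C k) * + X k) ≡ h * t [mod p ]
    sum≡ = mod-trans (≡⇒mod (trans (sum-binomial (λ k → + X k)) (binomialTransform-fibonacciLike n _ X-rec))) (halve 2X≡t)

  sum-term8 : ∀ X u → + 2 * binomialTransform n (+ 2) (- + 1) (λ j → + X j) ≡ u [mod p ] →
              sumℚ p (term8 X) ≡ halfℚ (ε * u) [modℚ p ]
  sum-term8 X u 2B≡u = ↦-≡[modℚ] p-prime (↦-resp (sum-↦ p-prime p (term8-↦ X)) sum≡) (halfℚ-↦ (ε * u))
    where
    B₁ = binomialTransform n (+ 1) (- h) (λ j → + X j)
    sum≡ : sumℤ p (λ k → + (n C k) * ((- h) ^ k * + X k)) ≡ h * (ε * u) [mod p ]
    sum≡ = begin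
      sumℤ p (λ k → + (n C k) * ((- h) ^ k * + X k))               ≡⟨ sum-binomial _ ⟩
      binomialTransform n (+ 1) (+ 1) (λ k → (- h) ^ k * + X k)     ≡⟨ binomialTransform-1+d n (- h) _ ⟨
      B₁                                                           ≡⟨ ℤ.*-identityˡ B₁ ⟨
      + 1 * B₁                                                     ≈⟨ mod-*ʳ B₁ (mod-sym ε²≡1) ⟩
      ε * ε * B₁                                                   ≈⟨ mod-*ʳ B₁ (mod-*ˡ ε (mod-sym (two-power-legendre {n} p-prime))) ⟩
      ε * (+ 2) ^ n * B₁                                           ≡⟨ ℤ.*-assoc ε _ B₁ ⟩
      ε * ((+ 2) ^ n * B₁)                                         ≡⟨ cong (ε *_) (binomialTransform-homogeneous n (+ 2) (+ 1) (- h) _) ⟨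
      ε * binomialTransform n (+ 2 * + 1) (+ 2 * - h) (λ j → + X j) ≈⟨ mod-*ˡ ε (binomialTransform-mod n mod-refl 2-h≡-1 (λ _ → mod-refl)) ⟩
      ε * binomialTransform n (+ 2) (- + 1) (λ j → + X j)          ≈⟨ mod-*ˡ ε (halve 2B≡u) ⟩
      ε * (h * u)                                                  ≡⟨ lemma ε h u ⟩
      h * (ε * u)                                                  ∎
      where
      open ModReasoning p
      lemma : ∀ e h u → e * (h * u) ≡ h * (e * u)
      lemma = solve-∀
      2-h≡-1 : + 2 * - h ≡ - + 1 [mod p ]
      2-h≡-1 = mod-trans (≡⇒mod (sym (ℤ.neg-distribʳ-* (+ 2) h))) (mod-neg 2h≡1)

odd-prime : ∀ {p} → Prime p → p ≢ 2 → ∃ λ n → p ≡ suc (n ℕ.+ n)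
odd-prime {p} p-prime p≢2 with p % 2 in p%2≡ | m%n<n p 2
... | 0 | _ with prime⇒irreducible p-prime (m%n≡0⇒n∣m p 2 p%2≡)
...   | inj₂ 2≡p = ⊥-elim (p≢2 (sym 2≡p))
odd-prime {p} p-prime p≢2 | 1 | _ =
  p / 2 , trans (m≡m%n+[m/n]*n p 2) (cong₂ ℕ._+_ p%2≡ (trans (ℕ.*-comm (p / 2) 2) (cong (p / 2 ℕ.+_) (ℕ.+-identityʳ (p / 2)))))
odd-prime {p} p-prime p≢2 | suc (suc _) | ℕ.s≤s (ℕ.s≤s ())

corollary1p8 : (p : ℕ) → (pr : Prime p) → p ≢ 2 →
      (sumℚ p (termNeg4 fib) ≡ halfℚ (+ 1 ℤ.- legendre (+ p) 5) [modℚ p ])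
    × (sumℚ p (termNeg4 lucas) ≡ halfℚ (+ 5 ℤ.* legendre (+ p) 5 ℤ.- + 1) [modℚ p ])
    × (sumℚ p (term8 fib) ≡ halfℚ (legendreP (+ 2) p pr ℤ.* (legendre (+ p) 5 ℤ.- + 1)) [modℚ p ])
    × (sumℚ p (term8 lucas) ≡ halfℚ (legendreP (+ 2) p pr ℤ.* (+ 5 ℤ.* legendre (+ p) 5 ℤ.- + 1)) [modℚ p ])
corollary1p8 p pr p≢2 with odd-prime pr p≢2
... | n , refl =
  sum-termNeg4 {n} pr fib fib-fibonacciLike _ 2F≡ ,
  sum-termNeg4 {n} pr lucas lucas-fibonacciLike _ 2L≡ ,
  sum-term8 {n} pr fib _ (mod-trans (≡⇒mod (trans (cong (+ 2 *_) (binomialTransform-2-1-fib n)) (lemma (+ fib (n ℕ.+ n)))))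
                                    (mod-trans (mod-neg 2F≡) (≡⇒mod (lemma′ (legendre (+ p) 5))))) ,
  sum-term8 {n} pr lucas _ (mod-trans (≡⇒mod (cong (+ 2 *_) (binomialTransform-2-1-lucas n))) 2L≡)
  where
  2F≡ = proj₁ (fibonacci-mod-prime {n} pr)
  2L≡ = proj₂ (fibonacci-mod-prime {n} pr)
  lemma : ∀ f → + 2 * - f ≡ - (+ 2 * f)
  lemma = solve-∀
  lemma′ : ∀ l → - (+ 1 - l) ≡ l - + 1
  lemma′ = solve-∀
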